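{- Let $\alpha=[1]\in\mathsf{CycHam}(\mathsf{P}_1)$ and let $F$ be the free right $\mathsf{Ham}$-module on one generator $a$ in component $\mathsf{P}_1$ (so $F(\Gamma)\cong\mathsf{Ham}(\Gamma)$ via $a\circ^\Gamma_{V_\Gamma}x\leftrightarrow x$). Then the morphism of right $\mathsf{Ham}$-modules $F\to\mathsf{CycHam}$ with $a\mapsto\alpha$ is surjective, and its kernel is the right submodule generated by $a\circ^{\mathsf{P}_2}_{\{1,2\}}\nu-a\circ^{\mathsf{P}_2}_{\{1,2\}}\nu^{(12)}$, where $\nu=(1,2)$ and $\nu^{(12)}=(2,1)$ in $\mathsf{Ham}(\mathsf{P}_2)$. That is, $\mathsf{CycHam}$ is generated by $\alpha$ subject to the relation $\alpha\circ^{\mathsf{P}_2}_{\{1,2\}}\nu=\alpha\circ^{\mathsf{P}_2}_{\{1,2\}}\nu^{(12)}$.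
   Context: Graphs are finite, simple, undirected; a tube is a nonempty vertex set inducing a connected subgraph; $\Gamma/G$ contracts the tube $G$ to a vertex $\{G\}$; $\mathsf{P}_n$ is the path on $\{1,\dots,n\}$. A contractad (over a field $\mathsf{k}$) is a family of vector spaces $\mathcal{P}(\Gamma)$ over nonempty connected graphs, functorial in isomorphisms, with unit in $\mathcal{P}(\mathsf{P}_1)$ and equivariant, unital, associative compositions $\circ^\Gamma_G:\mathcal{P}(\Gamma/G)\otimes\mathcal{P}(\Gamma|_G)\to\mathcal{P}(\Gamma)$. A right $\mathcal{P}$-module is a similar family $\mathcal{M}(\Gamma)$ with equivariant, unital, associative actions $\circ^\Gamma_G:\mathcal{M}(\Gamma/G)\otimes\mathcal{P}(\Gamma|_G)\to\mathcal{M}(\Gamma)$; the free right module on $\mathcal{V}$ is $(\mathcal{V}\circ\mathcal{P})(\Gamma)=\bigoplus_I\mathcal{V}(\Gamma/I)\otimes\bigotimes_{G\in I}\mathcal{P}(\Gamma|_G)$ over partitions $I$ of $V_\Gamma$ into tubes. $\mathsf{Ham}(\Gamma)$ has basis the directed Hamiltonian paths $(v_1,\dots,v_n)$; composition substitutes a path $(w_1,\dots,w_m)$ of $\Gamma|_G$ for $\{G\}$ in a path of $\Gamma/G$, giving the resulting sequence if the junctions are edges of $\Gamma$, and $0$ otherwise. $\mathsf{CycHam}(\Gamma)$ has basis the directed Hamiltonian cycles $[v_1,\dots,v_n]$ (orderings up to rotation with consecutive vertices and $v_n,v_1$ adjacent) for $n\ge3$, with the conventions that $\mathsf{CycHam}(\mathsf{P}_1)$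 is spanned by the loop $[1]$ and $\mathsf{CycHam}(\mathsf{P}_2)$ by $[1,2]$. The right $\mathsf{Ham}$-action: for a cycle $[v_1,\dots,v_{k-1},\{G\},v_{k+1},\dots,v_n]$ of $\Gamma/G$ and a path $(w_1,\dots,w_m)$ of $\Gamma|_G$, the result is $[v_1,\dots,v_{k-1},w_1,\dots,w_m,v_{k+1},\dots,v_n]$ if $v_{k-1}\sim w_1$ and $w_m\sim v_{k+1}$ (indices cyclic; if $\Gamma/G$ is one vertex, the result is $[w_1,\dots,w_m]$ when $m\le2$ or $w_m\sim w_1$), and $0$ otherwise. -}

module Defs where

open import Level using (Level; _⊔_; 0ℓ) renaming (suc to lsuc)
open import Data.Bool using (Bool; true; false; _∧_; _∨_; not; T)
open import Data.Unit using (⊤; tt)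
open import Data.Nat using (ℕ; zero; suc; _≡ᵇ_; _≤ᵇ_; _∸_)
open import Data.Fin using (Fin)
import Data.Fin.Properties as FinP
open import Data.List using (List; []; _∷_; _++_; map; concatMap; length; filter; foldr)
open import Data.Bool.ListAction using (all; any)
open import Data.List.Membership.Propositional.Properties using (∈-map⁺)
open import Data.List.Membership.Propositional using (_∈_)
open import Data.List.Relation.Unary.Any using (here; there)
import Data.List.Properties as ListP
open import Data.Maybe using (Maybe; just; nothing)
import Data.Maybe.Properties as MaybeP
open import Data.Product using (Σ; _,_; proj₁; proj₂; _×_)
open import Relation.Binary.PropositionalEquality using (_≡_; refl; cong)
open import Relation.Binary.Definitions using (DecidableEquality)
open import Relation.Nullary using (¬_; Dec; yes; no; does)
open import Algebra.Bundles using (CommutativeRing)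

record Field (c ℓ : Level) : Set (lsuc (c ⊔ ℓ)) where
  field
    commutativeRing : CommutativeRing c ℓ
  open CommutativeRing commutativeRing public
  field
    0≉1     : ¬ (0# ≈ 1#)
    inverse : ∀ x → ¬ (x ≈ 0#) → Σ Carrier (λ y → (x * y) ≈ 1#)

-- The vertex set is an arbitrary type
-- with decidable equality together with a list enumerating all of it
-- (finiteness); adjacency is a symmetric irreflexive Bool-valued relation.

record Graph : Set₁ where
  field
    V             : Set
    _≟_           : DecidableEquality V
    enum          : List V
    enum-complete : ∀ v → v ∈ enum
    adj           : V → V → Bool
    adj-sym       : ∀ u v → adj u v ≡ adj v u
    adj-irrefl    : ∀ v → adj v v ≡ false

data Walk (Γ : Graph) (S : Graph.V Γ → Bool) : Graph.V Γ → Graph.V Γ → Set where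
  here : ∀ {u} → T (S u) → Walk Γ S u u
  step : ∀ {u v w} → T (S u) → T (Graph.adj Γ u v) → Walk Γ S v w → Walk Γ S u w

Connected : Graph → Set
Connected Γ = Graph.V Γ × (∀ u v → Walk Γ (λ _ → true) u v)

record Tube (Γ : Graph) : Set where
  field
    mem       : Graph.V Γ → Bool
    nonempty  : Σ (Graph.V Γ) (λ v → T (mem v))
    connected : ∀ u v → T (mem u) → T (mem v) → Walk Γ mem u v

record Iso (Γ Δ : Graph) : Set where
  field
    to      : Graph.V Γ → Graph.V Δ
    from    : Graph.V Δ → Graph.V Γ
    to-from : ∀ y → to (from y) ≡ y
    from-to : ∀ x → from (to x) ≡ x
    adj-pres : ∀ u v → Graph.adj Δ (to u) (to v) ≡ Graph.adj Γ u v

T-irr : ∀ b (p q : T b) → p ≡ q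
T-irr true tt tt = refl

consIf : ∀ {a} {A : Set a} (b : Bool) → (T b → A) → List A → List A
consIf true  f l = f tt ∷ l
consIf false f l = l

consIf-∈ : ∀ {A : Set} b (p : T b) (f : T b → A) l → f p ∈ consIf b f l
consIf-∈ true tt f l = here refl

consIf-there : ∀ {A : Set} b (f : T b → A) l {a} → a ∈ l → a ∈ consIf b f l
consIf-there true  f l m = there m
consIf-there false f l m = m

Sub : {V : Set} → (V → Bool) → Set
Sub {V} P = Σ V (λ v → T (P v))

subEnum : {V : Set} (P : V → Bool) → List V → List (Sub P)
subEnum P []       = []
subEnum P (x ∷ xs) = consIf (P x) (λ q → (x , q)) (subEnum P xs)

subEnum-complete : {V : Set} (P : V → Bool) (xs : List V) (v : V) (p : T (P v)) →
                   v ∈ xs → (v , p) ∈ subEnum P xs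
subEnum-complete P (x ∷ xs) .x p (here refl) = consIf-∈ (P x) p (λ q → (x , q)) (subEnum P xs)
subEnum-complete P (x ∷ xs) v p (there m) =
  consIf-there (P x) (λ q → (x , q)) (subEnum P xs) (subEnum-complete P xs v p m)

Sub-≟ : {V : Set} → DecidableEquality V → (P : V → Bool) → DecidableEquality (Sub P)
Sub-≟ _≟_ P (x , p) (y , q) with x ≟ y
... | yes refl = yes (cong (x ,_) (T-irr _ p q))
... | no ne    = no (λ e → ne (cong proj₁ e))

-- Restriction Γ|G and contraction Γ/G.
-- Vertices of Γ|G: vertices of Γ lying in G.
-- Vertices of Γ/G: nothing = the new vertex {G}, just v for v ∉ G.

module _ (Γ : Graph) (G : Tube Γ) where
  private
    module Γ = Graph Γ
    open Tube G

  restrict : Graph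
  restrict = record
    { V = Sub mem
    ; _≟_ = Sub-≟ Γ._≟_ mem
    ; enum = subEnum mem Γ.enum
    ; enum-complete = λ { (v , p) → subEnum-complete mem Γ.enum v p (Γ.enum-complete v) }
    ; adj = λ u v → Γ.adj (proj₁ u) (proj₁ v)
    ; adj-sym = λ u v → Γ.adj-sym (proj₁ u) (proj₁ v)
    ; adj-irrefl = λ v → Γ.adj-irrefl (proj₁ v)
    }

  touches : Γ.V → Bool
  touches v = any (λ u → mem u ∧ Γ.adj u v) Γ.enum

  VC : Set
  VC = Maybe (Sub (λ v → not (mem v)))

  adjC : VC → VC → Bool
  adjC nothing         nothing         = false
  adjC nothing         (just (v , _))  = touches v
  adjC (just (v , _))  nothing         = touches v
  adjC (just (u , _))  (just (v , _))  = Γ.adj u v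

  private
    adjC-sym : ∀ u v → adjC u v ≡ adjC v u
    adjC-sym nothing nothing = refl
    adjC-sym nothing (just _) = refl
    adjC-sym (just _) nothing = refl
    adjC-sym (just (u , _)) (just (v , _)) = Γ.adj-sym u v

    adjC-irrefl : ∀ v → adjC v v ≡ false
    adjC-irrefl nothing = refl
    adjC-irrefl (just (v , _)) = Γ.adj-irrefl v

    enumC-complete : ∀ v → v ∈ (nothing ∷ map just (subEnum (λ v → not (mem v)) Γ.enum))
    enumC-complete nothing = here refl
    enumC-complete (just (v , p)) =
      there (∈-map⁺ just (subEnum-complete (λ v → not (mem v)) Γ.enum v p (Γ.enum-complete v)))

  contract : Graph
  contract = record
    { V = VC
    ; _≟_ = MaybeP.≡-dec (Sub-≟ Γ._≟_ (λ v → not (mem v)))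
    ; enum = nothing ∷ map just (subEnum (λ v → not (mem v)) Γ.enum)
    ; enum-complete = enumC-complete
    ; adj = adjC
    ; adj-sym = adjC-sym
    ; adj-irrefl = adjC-irrefl
    }

module _ (Γ : Graph) where
  open Graph Γ

  count : V → List V → ℕ
  count v l = length (filter (v ≟_) l)

  chain : List V → Bool
  chain []            = true
  chain (x ∷ [])      = true
  chain (x ∷ y ∷ r)   = adj x y ∧ chain (y ∷ r)

  isHam : List V → Bool
  isHam l = all (λ v → count v l ≡ᵇ 1) enum ∧ chain l

  HamPath : Set
  HamPath = Σ (List V) (λ l → T (isHam l))

  lastOf : V → List V → V
  lastOf x []       = x
  lastOf x (y ∷ r)  = lastOf y r

  endsAdj : List V → Bool
  endsAdj []       = false
  endsAdj (x ∷ r)  = adj (lastOf x r) x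

  -- orderings representing a Hamiltonian cycle (n ≤ 2: loop / [1,2] conventions)
  isCyc : List V → Bool
  isCyc l = isHam l ∧ ((length l ≤ᵇ 2) ∨ endsAdj l)

  -- cycles are orderings up to rotation
  CycRep : Set
  CycRep = Σ (List V) (λ l → T (isCyc l))

  rot1 : List V → List V
  rot1 []       = []
  rot1 (x ∷ r)  = r ++ (x ∷ [])

  rotsN : ℕ → List V → List (List V)
  rotsN zero    l = l ∷ []
  rotsN (suc n) l = l ∷ rotsN n (rot1 l)

  rotations : List V → List (List V)
  rotations l = rotsN (length l) l

  sameList : List V → List V → Bool
  sameList l l' = does (ListP.≡-dec _≟_ l l')

  sameCycle : List V → List V → Bool
  sameCycle l l' = any (λ r → sameList r l') (rotations l)

-- The vector spaces Ham(Γ), CycHam(Γ) over a field K: finite formal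
-- linear combinations of basis elements, compared coefficientwise.

module _ {c ℓ : Level} (K : Field c ℓ) where
  open Field K

  HVec : Graph → Set c
  HVec Γ = List (Carrier × HamPath Γ)

  CVec : Graph → Set c
  CVec Γ = List (Carrier × CycRep Γ)

  coeffH : (Γ : Graph) → HVec Γ → List (Graph.V Γ) → Carrier
  coeffH Γ u l = foldr (λ e acc → if′ (sameList Γ (proj₁ (proj₂ e)) l) (proj₁ e + acc) acc) 0# u
    where
      if′ : Bool → Carrier → Carrier → Carrier
      if′ true  a b = a
      if′ false a b = b

  coeffC : (Γ : Graph) → CVec Γ → List (Graph.V Γ) → Carrier
  coeffC Γ u l = foldr (λ e acc → if′ (sameCycle Γ (proj₁ (proj₂ e)) l) (proj₁ e + acc) acc) 0# u
    where
      if′ : Bool → Carrier → Carrier → Carrier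
      if′ true  a b = a
      if′ false a b = b

  _≈H_ : {Γ : Graph} → HVec Γ → HVec Γ → Set ℓ
  _≈H_ {Γ} u w = ∀ (p : HamPath Γ) → coeffH Γ u (proj₁ p) ≈ coeffH Γ w (proj₁ p)

  _≈C_ : {Γ : Graph} → CVec Γ → CVec Γ → Set ℓ
  _≈C_ {Γ} u w = ∀ (z : CycRep Γ) → coeffC Γ u (proj₁ z) ≈ coeffC Γ w (proj₁ z)

  scaleH : {Γ : Graph} → Carrier → HVec Γ → HVec Γ
  scaleH a u = map (λ e → (a * proj₁ e , proj₂ e)) u

  -- Contractad composition of Ham at a tube G:
  -- substitute the path of Γ|G for {G} in the path of Γ/G, keep the
  -- result iff both junctions are edges of Γ.
  module _ (Γ : Graph) (G : Tube Γ) where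
    open Graph Γ

    substitute : List (VC Γ G) → List (Sub (Tube.mem G)) → List V
    substitute p q = concatMap (λ { nothing → map proj₁ q ; (just (v , _)) → v ∷ [] }) p

    leftOK : Maybe V → List V → Bool
    leftOK nothing  w        = true
    leftOK (just u) []       = true
    leftOK (just u) (w ∷ _)  = adj u w

    rightOK : List V → List (VC Γ G) → Bool
    rightOK []       r                    = true
    rightOK (w ∷ ws) []                   = true
    rightOK (w ∷ ws) (nothing ∷ _)        = true
    rightOK (w ∷ ws) (just (v , _) ∷ _)   = adj (lastOf Γ w ws) v

    -- prev = vertex preceding the current position
    junctions : Maybe V → List (VC Γ G) → List V → Bool
    junctions prev []                   w = true
    junctions prev (nothing ∷ r)        w = leftOK prev w ∧ rightOK w r
    junctions prev (just (v , _) ∷ r)   w = junctions (just v) r w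

    -- basis-level composition: a list with zero or one path
    -- (the isHam guard only packages the proof; it always holds when the
    -- junctions are edges and the inputs are Hamiltonian paths)
    composeB : HamPath (contract Γ G) → HamPath (restrict Γ G) → List (HamPath Γ)
    composeB (p , _) (q , _) with junctions nothing p (map proj₁ q)
    ... | false = []
    ... | true  = consIf (isHam Γ (substitute p q)) (λ h → (substitute p q , h)) []

    compose : HVec (contract Γ G) → HVec (restrict Γ G) → HVec Γ
    compose m x = concatMap (λ e → concatMap (λ f →
                    map (λ r → (proj₁ e * proj₁ f , r)) (composeB (proj₂ e) (proj₂ f))) x) m

  relabel : {Γ Δ : Graph} → Iso Γ Δ → HVec Γ → HVec Δ
  relabel {Γ} {Δ} σ u = concatMap (λ e →
      consIf (isHam Δ (map (Iso.to σ) (proj₁ (proj₂ e))))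
             (λ h → (proj₁ e , (map (Iso.to σ) (proj₁ (proj₂ e)) , h))) []) u

  -- The module map F → CycHam, a ↦ α = [1].  Under F(Γ) ≅ Ham(Γ),
  -- x ↦ α ∘^Γ_{V_Γ} x, i.e. (w₁,…,w_m) ↦ [w₁,…,w_m] if m ≤ 2 or w_m ∼ w₁,
  -- and 0 otherwise.
  close : (Γ : Graph) → HVec Γ → CVec Γ
  close Γ u = foldr (λ e acc →
      consIf (isCyc Γ (proj₁ (proj₂ e))) (λ h → (proj₁ e , (proj₁ (proj₂ e) , h))) acc) [] u

-- The path graph P₂ (vertices 1,2 encoded as Fin 2 elements 0,1)

private
  adj2 : Fin 2 → Fin 2 → Bool
  adj2 i j = not (does (i FinP.≟ j))

  adj2-sym : ∀ i j → adj2 i j ≡ adj2 j i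
  adj2-sym Fin.zero Fin.zero = refl
  adj2-sym Fin.zero (Fin.suc Fin.zero) = refl
  adj2-sym (Fin.suc Fin.zero) Fin.zero = refl
  adj2-sym (Fin.suc Fin.zero) (Fin.suc Fin.zero) = refl

  adj2-irrefl : ∀ i → adj2 i i ≡ false
  adj2-irrefl Fin.zero = refl
  adj2-irrefl (Fin.suc Fin.zero) = refl

  enum2-complete : ∀ (i : Fin 2) → i ∈ (Fin.zero ∷ Fin.suc Fin.zero ∷ []) 
  enum2-complete Fin.zero = here refl
  enum2-complete (Fin.suc Fin.zero) = there (here refl)

P₂ : Graph
P₂ = record
  { V = Fin 2
  ; _≟_ = FinP._≟_
  ; enum = Fin.zero ∷ Fin.suc Fin.zero ∷ [] 
  ; enum-complete = enum2-complete
  ; adj = adj2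
  ; adj-sym = adj2-sym
  ; adj-irrefl = adj2-irrefl
  }

ν : HamPath P₂
ν = (Fin.zero ∷ Fin.suc Fin.zero ∷ []) , tt

ν⁽¹²⁾ : HamPath P₂
ν⁽¹²⁾ = (Fin.suc Fin.zero ∷ Fin.zero ∷ []) , tt

relation : ∀ {c ℓ} (K : Field c ℓ) → HVec K P₂
relation K = (1# , ν) ∷ ((- 1#) , ν⁽¹²⁾) ∷ []
  where open Field K

-- The right Ham-submodule of F ≅ Ham generated by the relation:
-- the smallest family of subspaces containing it, closed under
-- isomorphisms and under the right Ham-action.

data InSub {c ℓ} (K : Field c ℓ) : (Γ : Graph) → HVec K Γ → Set (lsuc 0ℓ ⊔ c ⊔ ℓ) where
  gen    : InSub K P₂ (relation K)
  zero   : ∀ {Γ} → InSub K Γ []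
  add    : ∀ {Γ u w} → InSub K Γ u → InSub K Γ w → InSub K Γ (u ++ w)
  scale  : ∀ {Γ u} (a : Field.Carrier K) → InSub K Γ u → InSub K Γ (scaleH K a u)
  resp   : ∀ {Γ u w} → _≈H_ K u w → InSub K Γ u → InSub K Γ w
  iso    : ∀ {Γ Δ u} (σ : Iso Γ Δ) → InSub K Γ u → InSub K Δ (relabel K σ u)
  act    : ∀ {Γ} (G : Tube Γ) {m} → InSub K (contract Γ G) m →
           (x : HVec K (restrict Γ G)) → InSub K Γ (compose K Γ G m x)

module Submission where

-- Evaluate formal combinations x ∈ Ham(Γ) against functionals given by
-- functions f on vertex lists. The coefficient of close x at a cycle z is the sum of the
-- coefficients of x over the rotations of z, so close x = 0 says that all these class sums
-- vanish, and then x is killed by every functional that is rotation invariant and vanishes off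
-- cycles. The relation lies in the kernel because ν⁽¹²⁾ is a rotation of ν, and the kernel is
-- stable under relabelling and the Ham-action, because substituting into a non-cyclic path
-- never gives a cycle while substituting into a rotation rotates the result.
-- Conversely, inserting the relation at the tube V∖{v₁} of a path v₁ … vₙ gives
-- (v₂ … vₙ v₁) − (v₁ … vₙ), the first term present only if vₙ ∼ v₁. So modulo the submodule a
-- cyclic path equals its rotation starting at a fixed vertex and a non-cyclic path is 0; a
-- kernel element is thus congruent to its combination of canonical rotations, which is 0.
-- Surjectivity is clear, each cyclic ordering being a path.

open import Level using (Level; 0ℓ; _⊔_) renaming (suc to lsuc)
open import Function using (Equivalence; _∘_)
open import Data.Bool using (Bool; true; false; _∧_; _∨_; not; T; if_then_else_)
open import Data.Bool.Properties using (T?; T-≡; T-∧; T-∨)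
open import Data.Bool.ListAction using (all; any)
open import Data.Unit using (tt)
open import Data.Empty using (⊥; ⊥-elim)
open import Data.Nat using (ℕ; zero; suc; _≤_; z≤n; s≤s; _≤ᵇ_; _≡ᵇ_)
open import Data.Nat.Properties
  using (≡ᵇ⇒≡; ≡⇒≡ᵇ; ≤ᵇ⇒≤; 1+n≢0; ≤-refl; ≤-trans; suc-injective; m≤n⇒m<n∨m≡n; n≤1+n; m≤n⇒m≤1+n)
open import Data.List using (List; []; _∷_; _++_; map; concatMap; length; initLast; _∷ʳ′_)
open import Data.List.Properties
  using (≡-dec; length-++; length-++-≤ʳ; length-map; ++-assoc; ++-identityʳ; map-++)
open import Data.List.Membership.Propositional using (_∈_)
open import Data.List.Membership.Propositional.Properties using (∈-++⁺ʳ)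
open import Data.List.Relation.Unary.Any using (here; there)
open import Data.Maybe using (just; nothing)
open import Data.Fin using (Fin)
open import Data.Product using (Σ; _,_; proj₁; proj₂; _×_)
open import Data.Sum using (_⊎_; inj₁; inj₂)
open import Relation.Binary.PropositionalEquality
  using (_≡_; _≢_; refl; sym; trans; cong; cong₂; subst)
open import Relation.Nullary using (¬_; yes; no; does)
open import Relation.Binary.Structures using (IsEquivalence)

open import Defs
import Algebra.Properties.AbelianGroup
import Algebra.Properties.Ring
import Algebra.Properties.CommutativeSemigroup

∧⁺ : ∀ {a b} → T a → T b → T (a ∧ b)
∧⁺ p q = Equivalence.from T-∧ (p , q)

∧⁻ˡ : ∀ {a b} → T (a ∧ b) → T a
∧⁻ˡ p = proj₁ (Equivalence.to T-∧ p)

∧⁻ʳ : ∀ {a b} → T (a ∧ b) → T b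
∧⁻ʳ p = proj₂ (Equivalence.to T-∧ p)

∨⁺ˡ : ∀ {a b} → T a → T (a ∨ b)
∨⁺ˡ p = Equivalence.from T-∨ (inj₁ p)

∨⁺ʳ : ∀ {a b} → T b → T (a ∨ b)
∨⁺ʳ p = Equivalence.from T-∨ (inj₂ p)

∨⁻ : ∀ {a b} → T (a ∨ b) → T a ⊎ T b
∨⁻ = Equivalence.to T-∨

T-ext : ∀ {a b} → (T a → T b) → (T b → T a) → a ≡ b
T-ext {true}  {true}  _ _ = refl
T-ext {true}  {false} f _ = ⊥-elim (f tt)
T-ext {false} {true}  _ g = ⊥-elim (g tt)
T-ext {false} {false} _ _ = refl

≡true⇒T : ∀ {b} → b ≡ true → T b
≡true⇒T = Equivalence.from T-≡

≡false⇒¬T : ∀ {b} → b ≡ false → ¬ T b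
≡false⇒¬T {true} () _

¬T⇒≡false : ∀ {b} → ¬ T b → b ≡ false
¬T⇒≡false {true}  ¬t = ⊥-elim (¬t tt)
¬T⇒≡false {false} _  = refl

consIf-T : ∀ {a} {A : Set a} b (p : T b) (f : T b → A) l → consIf b f l ≡ f p ∷ l
consIf-T true _ f l = refl

all-∈ : ∀ {A : Set} (f : A → Bool) xs {x} → T (all f xs) → x ∈ xs → T (f x)
all-∈ f (y ∷ xs) p (here refl) = ∧⁻ˡ p
all-∈ f (y ∷ xs) p (there m)   = all-∈ f xs (∧⁻ʳ {f y} p) m

all-intro : ∀ {A : Set} (f : A → Bool) xs → (∀ x → x ∈ xs → T (f x)) → T (all f xs)
all-intro f []       h = tt
all-intro f (y ∷ xs) h = ∧⁺ (h y (here refl)) (all-intro f xs (λ x m → h x (there m)))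

any-intro : ∀ {A : Set} (f : A → Bool) xs {x} → T (f x) → x ∈ xs → T (any f xs)
any-intro f (y ∷ xs) p (here refl) = ∨⁺ˡ p
any-intro f (y ∷ xs) p (there m)   = ∨⁺ʳ {f y} (any-intro f xs p m)

any-elim : ∀ {A : Set} (f : A → Bool) xs → T (any f xs) → Σ A (λ x → x ∈ xs × T (f x))
any-elim f (y ∷ xs) p with ∨⁻ {f y} p
... | inj₁ q = y , here refl , q
... | inj₂ q with any-elim f xs q
...   | x , m , r = x , there m , r

all-cong : ∀ {A : Set} (f g : A → Bool) xs → (∀ x → f x ≡ g x) → all f xs ≡ all g xs
all-cong f g []       h = refl
all-cong f g (y ∷ xs) h = cong₂ _∧_ (h y) (all-cong f g xs h)

module Cycles (Γ : Graph) where
  open Graph Γ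
  open import Data.Nat using (_+_)
  open import Data.Nat.Properties using (+-comm)

  rot : List V → List V
  rot = rot1 Γ

  rotN : ℕ → List V → List V
  rotN zero    l = l
  rotN (suc k) l = rotN k (rot l)

  length-rot : ∀ l → length (rot l) ≡ length l
  length-rot []      = refl
  length-rot (x ∷ l) = trans (length-++ l) (+-comm (length l) 1)

  rotN-++ : ∀ a b → rotN (length a) (a ++ b) ≡ b ++ a
  rotN-++ []      b = sym (++-identityʳ b)
  rotN-++ (x ∷ a) b = begin
    rotN (length a) ((a ++ b) ++ x ∷ [])  ≡⟨ cong (rotN (length a)) (++-assoc a b (x ∷ [])) ⟩
    rotN (length a) (a ++ b ++ x ∷ [])    ≡⟨ rotN-++ a (b ++ x ∷ []) ⟩
    (b ++ x ∷ []) ++ a                    ≡⟨ ++-assoc b (x ∷ []) a ⟩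
    b ++ x ∷ a                            ∎
    where open Relation.Binary.PropositionalEquality.≡-Reasoning

  rotN-length : ∀ l → rotN (length l) l ≡ l
  rotN-length l = trans (cong (rotN (length l)) (sym (++-identityʳ l))) (rotN-++ l [])

  rotsN-∈ : ∀ n l k → k ≤ n → rotN k l ∈ rotsN Γ n l
  rotsN-∈ zero    l zero    _         = here refl
  rotsN-∈ (suc n) l zero    _         = here refl
  rotsN-∈ (suc n) l (suc k) (s≤s k≤n) = there (rotsN-∈ n (rot l) k k≤n)

  ∈-rotsN : ∀ n l {m} → m ∈ rotsN Γ n l → Σ ℕ (λ k → k ≤ n × rotN k l ≡ m)
  ∈-rotsN zero    l (here refl) = 0 , z≤n , refl
  ∈-rotsN (suc n) l (here refl) = 0 , z≤n , refl
  ∈-rotsN (suc n) l (there m) with ∈-rotsN n (rot l) m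
  ... | k , k≤n , eq = suc k , s≤s k≤n , eq

  sameList⇒≡ : ∀ l m → T (sameList Γ l m) → l ≡ m
  sameList⇒≡ l m p with ≡-dec _≟_ l m
  ... | yes eq = eq

  sameList-refl : ∀ l → T (sameList Γ l l)
  sameList-refl l with ≡-dec _≟_ l l
  ... | yes _ = tt
  ... | no l≢l = l≢l refl

  sameCycle⇒rotN : ∀ l m → T (sameCycle Γ l m) → Σ ℕ (λ k → k ≤ length l × rotN k l ≡ m)
  sameCycle⇒rotN l m p with any-elim (λ r → sameList Γ r m) (rotations Γ l) p
  ... | r , r∈ , same with ∈-rotsN (length l) l r∈
  ...   | k , k≤ , eq = k , k≤ , trans eq (sameList⇒≡ r m same)

  rotN⇒sameCycle : ∀ l k → k ≤ length l → T (sameCycle Γ l (rotN k l))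
  rotN⇒sameCycle l k k≤ =
    any-intro (λ r → sameList Γ r (rotN k l)) (rotations Γ l) (sameList-refl (rotN k l))
              (rotsN-∈ (length l) l k k≤)

  sameCycle-rot : ∀ l m → sameCycle Γ (rot l) m ≡ sameCycle Γ l m
  sameCycle-rot []      m = refl
  sameCycle-rot (x ∷ l) m = T-ext fwd bwd
    where
      L = x ∷ l
      n = length l
      fwd : T (sameCycle Γ (rot L) m) → T (sameCycle Γ L m)
      fwd p with sameCycle⇒rotN (rot L) m p
      ... | k , k≤ , refl with m≤n⇒m<n∨m≡n (subst (k ≤_) (length-rot L) k≤)
      ...   | inj₁ k<  = rotN⇒sameCycle L (suc k) k<
      ...   | inj₂ refl = subst (λ r → T (sameCycle Γ L r))
                            (sym (subst (λ j → rotN j (rot L) ≡ rot L) (length-rot L) (rotN-length (rot L))))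
                            (rotN⇒sameCycle L 1 (s≤s z≤n))
      bwd : T (sameCycle Γ L m) → T (sameCycle Γ (rot L) m)
      bwd p with sameCycle⇒rotN L m p
      ... | zero  , _       , refl = subst (λ r → T (sameCycle Γ (rot L) r)) (rotN-length L)
                                    (rotN⇒sameCycle (rot L) n (subst (n ≤_) (sym (length-rot L)) (n≤1+n n)))
      ... | suc k , s≤s k≤ , refl =
        rotN⇒sameCycle (rot L) k (subst (k ≤_) (sym (length-rot L)) (m≤n⇒m≤1+n k≤))

  sameCycle-rotN : ∀ k l m → sameCycle Γ (rotN k l) m ≡ sameCycle Γ l m
  sameCycle-rotN zero    l m = refl
  sameCycle-rotN (suc k) l m = trans (sameCycle-rotN k (rot l) m) (sameCycle-rot l m)

  sameCycle-refl : ∀ l → T (sameCycle Γ l l)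
  sameCycle-refl l = rotN⇒sameCycle l 0 z≤n

  sameCycle-sym : ∀ {l m} → T (sameCycle Γ l m) → T (sameCycle Γ m l)
  sameCycle-sym {l} {m} p with sameCycle⇒rotN l m p
  ... | k , _ , refl = subst T (sym (sameCycle-rotN k l l)) (sameCycle-refl l)

  sameCycle-trans : ∀ {l m n} → T (sameCycle Γ l m) → T (sameCycle Γ m n) → T (sameCycle Γ l n)
  sameCycle-trans {l} {m} {n} p q with sameCycle⇒rotN l m p
  ... | k , _ , refl = subst T (sameCycle-rotN k l n) q

  count-++ : ∀ v a b → count Γ v (a ++ b) ≡ count Γ v a + count Γ v b
  count-++ v []      b = refl
  count-++ v (x ∷ a) b with v ≟ x
  ... | yes _ = cong suc (count-++ v a b)
  ... | no  _ = count-++ v a b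

  count-rot : ∀ v l → count Γ v (rot l) ≡ count Γ v l
  count-rot v []      = refl
  count-rot v (x ∷ l) = trans (count-++ v l (x ∷ []))
    (trans (+-comm (count Γ v l) (count Γ v (x ∷ []))) (sym (count-++ v (x ∷ []) l)))

  count-head : ∀ v l → count Γ v (v ∷ l) ≡ suc (count Γ v l)
  count-head v l with v ≟ v
  ... | yes _   = refl
  ... | no  v≢v = ⊥-elim (v≢v refl)

  count-≢ : ∀ v u l → v ≢ u → count Γ v (u ∷ l) ≡ count Γ v l
  count-≢ v u l v≢u with v ≟ u
  ... | yes v≡u = ⊥-elim (v≢u v≡u)
  ... | no  _   = refl

  count≢0⇒∈ : ∀ v l → count Γ v l ≢ 0 → v ∈ l
  count≢0⇒∈ v []      ne = ⊥-elim (ne refl)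
  count≢0⇒∈ v (x ∷ l) ne with v ≟ x
  ... | yes refl = here refl
  ... | no  _    = there (count≢0⇒∈ v l ne)

  count≡0⇒∉ : ∀ v l → count Γ v l ≡ 0 → v ∈ l → ⊥
  count≡0⇒∉ v (x ∷ l) c (here refl) with v ≟ v
  ... | yes _   = 1+n≢0 c
  ... | no  v≢v = v≢v refl
  count≡0⇒∉ v (x ∷ l) c (there v∈) with v ≟ x
  ... | yes _ = 1+n≢0 c
  ... | no  _ = count≡0⇒∉ v l c v∈

  isHam⇒count≡1 : ∀ l v → T (isHam Γ l) → count Γ v l ≡ 1
  isHam⇒count≡1 l v h =
    ≡ᵇ⇒≡ (count Γ v l) 1 (all-∈ (λ w → count Γ w l ≡ᵇ 1) enum (∧⁻ˡ h) (enum-complete v))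

  lastOf-snoc : ∀ y r x → lastOf Γ y (r ++ x ∷ []) ≡ x
  lastOf-snoc y []      x = refl
  lastOf-snoc y (z ∷ r) x = lastOf-snoc z r x

  lastOf-++ : ∀ y a x b → lastOf Γ y (a ++ x ∷ b) ≡ lastOf Γ x b
  lastOf-++ y []      x b = refl
  lastOf-++ y (z ∷ a) x b = lastOf-++ z a x b

  chain-tail : ∀ u l → T (chain Γ (u ∷ l)) → T (chain Γ l)
  chain-tail u []      c = tt
  chain-tail u (x ∷ l) c = ∧⁻ʳ {adj u x} c

  chain⇒adj-lastOf : ∀ y a x b → T (chain Γ (y ∷ a ++ x ∷ b)) → T (adj (lastOf Γ y a) x)
  chain⇒adj-lastOf y []      x b c = ∧⁻ˡ c
  chain⇒adj-lastOf y (z ∷ a) x b c = chain⇒adj-lastOf z a x b (∧⁻ʳ {adj y z} c)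

  chain-snoc : ∀ y r x → T (chain Γ (y ∷ r)) → T (adj (lastOf Γ y r) x) → T (chain Γ ((y ∷ r) ++ x ∷ []))
  chain-snoc y []      x c a = ∧⁺ a tt
  chain-snoc y (z ∷ r) x c a = ∧⁺ (∧⁻ˡ c) (chain-snoc z r x (∧⁻ʳ {adj y z} c) a)

  chain-snoc⁻ : ∀ y r x → T (chain Γ ((y ∷ r) ++ x ∷ [])) → T (adj (lastOf Γ y r) x)
  chain-snoc⁻ y []      x c = ∧⁻ˡ c
  chain-snoc⁻ y (z ∷ r) x c = chain-snoc⁻ z r x (∧⁻ʳ {adj y z} c)

  adj-symᵀ : ∀ {u v} → T (adj u v) → T (adj v u)
  adj-symᵀ {u} {v} = subst T (adj-sym u v)

  isCyc⇒isHam : ∀ l → T (isCyc Γ l) → T (isHam Γ l)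
  isCyc⇒isHam l = ∧⁻ˡ

  counts-rot : ∀ l → all (λ w → count Γ w (rot l) ≡ᵇ 1) enum ≡ all (λ w → count Γ w l ≡ᵇ 1) enum
  counts-rot l = all-cong _ _ enum (λ w → cong (_≡ᵇ 1) (count-rot w l))

  isCyc-rot : ∀ l → T (isCyc Γ l) → T (isCyc Γ (rot l))
  isCyc-rot []              c = c
  isCyc-rot (x ∷ [])        c = c
  isCyc-rot (x ∷ y ∷ [])    c =
    ∧⁺ (∧⁺ (subst T (sym (counts-rot (x ∷ y ∷ []))) (∧⁻ˡ (∧⁻ˡ c)))
           (∧⁺ (adj-symᵀ (∧⁻ˡ (∧⁻ʳ {all _ enum} (∧⁻ˡ c)))) tt)) tt
  isCyc-rot (x ∷ y ∷ z ∷ r) c =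
    ∧⁺ (∧⁺ (subst T (sym (counts-rot L)) (∧⁻ˡ (∧⁻ˡ c))) links) (∨⁺ʳ {length (rot L) ≤ᵇ 2} closing)
    where
      L = x ∷ y ∷ z ∷ r
      links-L : T (chain Γ L)
      links-L = ∧⁻ʳ {all _ enum} (∧⁻ˡ c)
      links : T (chain Γ (rot L))
      links = chain-snoc y (z ∷ r) x (∧⁻ʳ {adj x y} links-L) (∧⁻ʳ {isHam Γ L} c)
      closing : T (endsAdj Γ (rot L))
      closing = subst (λ w → T (adj w y)) (sym (lastOf-snoc z r x)) (∧⁻ˡ links-L)

  isCyc-rotN : ∀ k l → T (isCyc Γ l) → T (isCyc Γ (rotN k l))
  isCyc-rotN zero    l c = c
  isCyc-rotN (suc k) l c = isCyc-rotN k (rot l) (isCyc-rot l c)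

  isCyc-rot-≡ : ∀ l → isCyc Γ (rot l) ≡ isCyc Γ l
  isCyc-rot-≡ []      = refl
  isCyc-rot-≡ (x ∷ l) = T-ext back (isCyc-rot (x ∷ l))
    where back : T (isCyc Γ (rot (x ∷ l))) → T (isCyc Γ (x ∷ l))
          back c = subst (T ∘ isCyc Γ) (rotN-length (x ∷ l)) (isCyc-rotN (length l) (rot (x ∷ l)) c)

  isCyc-rotN-≡ : ∀ k l → isCyc Γ (rotN k l) ≡ isCyc Γ l
  isCyc-rotN-≡ zero    l = refl
  isCyc-rotN-≡ (suc k) l = trans (isCyc-rotN-≡ k (rot l)) (isCyc-rot-≡ l)

  sameCycle⇒isCyc-≡ : ∀ {l m} → T (sameCycle Γ l m) → isCyc Γ l ≡ isCyc Γ m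
  sameCycle⇒isCyc-≡ {l} {m} p with sameCycle⇒rotN l m p
  ... | k , _ , refl = sym (isCyc-rotN-≡ k l)

  module Anchored (e₀ : V) where

    anchorIndex : List V → ℕ
    anchorIndex []      = 0
    anchorIndex (x ∷ l) with e₀ ≟ x
    ... | yes _ = 0
    ... | no  _ = suc (anchorIndex l)

    canon : List V → List V
    canon l = rotN (anchorIndex l) l

    anchorIndex-head : ∀ l → anchorIndex (e₀ ∷ l) ≡ 0
    anchorIndex-head l with e₀ ≟ e₀
    ... | yes _   = refl
    ... | no e≢e = ⊥-elim (e≢e refl)

    anchorIndex-++-∈ : ∀ a b → count Γ e₀ a ≢ 0 → anchorIndex (a ++ b) ≡ anchorIndex a
    anchorIndex-++-∈ []      b ne = ⊥-elim (ne refl)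
    anchorIndex-++-∈ (x ∷ a) b ne with e₀ ≟ x
    ... | yes _ = refl
    ... | no  _ = cong suc (anchorIndex-++-∈ a b ne)

    anchorIndex-++-∉ : ∀ a b → count Γ e₀ a ≡ 0 → anchorIndex (a ++ b) ≡ length a + anchorIndex b
    anchorIndex-++-∉ []      b _  = refl
    anchorIndex-++-∉ (x ∷ a) b c0 with e₀ ≟ x
    ... | yes _ = ⊥-elim (1+n≢0 c0)
    ... | no  _ = cong suc (anchorIndex-++-∉ a b c0)

    canon-rot : ∀ l → count Γ e₀ l ≡ 1 → canon (rot l) ≡ canon l
    canon-rot []      _  = refl
    canon-rot (x ∷ r) c1 with e₀ ≟ x
    ... | yes refl = trans (cong (λ k → rotN k (r ++ e₀ ∷ [])) index≡) (rotN-++ r (e₀ ∷ []))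
      where index≡ : anchorIndex (r ++ e₀ ∷ []) ≡ length r
            index≡ = trans (anchorIndex-++-∉ r (e₀ ∷ []) (suc-injective c1))
                           (trans (cong (length r +_) (anchorIndex-head [])) (+-comm (length r) 0))
    ... | no  _    = cong (λ k → rotN k (r ++ x ∷ [])) (anchorIndex-++-∈ r (x ∷ []) (λ c0 → 1+n≢0 (trans (sym c1) c0)))

module FormalSums {c ℓ : Level} (K : Field c ℓ) where
  open Field K renaming (refl to ≈-refl; sym to ≈-sym; trans to ≈-trans)
  open import Relation.Binary.Reasoning.Setoid setoid
  private
    module AG  = Algebra.Properties.AbelianGroup +-abelianGroup
    module R   = Algebra.Properties.Ring ring
    module +CS = Algebra.Properties.CommutativeSemigroup +-commutativeSemigroup
    module *CS = Algebra.Properties.CommutativeSemigroup *-commutativeSemigroup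

  ind : Bool → Carrier
  ind true  = 1#
  ind false = 0#

  when : Bool → Carrier → Carrier
  when true  x = x
  when false _ = 0#

  when-T : ∀ {b} x → T b → when b x ≡ x
  when-T {true} x _ = refl

  when-¬T : ∀ {b} x → ¬ T b → when b x ≈ 0#
  when-¬T {true}  x ¬t = ⊥-elim (¬t tt)
  when-¬T {false} x _  = ≈-refl

  when-ind : ∀ b d → (T d → T b) → when b (ind d) ≈ ind d
  when-ind true  d       _ = ≈-refl
  when-ind false true  d⇒b = ⊥-elim (d⇒b tt)
  when-ind false false _   = ≈-refl

  ≡⇒≈ : ∀ {x y} → x ≡ y → x ≈ y
  ≡⇒≈ refl = ≈-refl

  x-y≈0⇒x≈y : ∀ x y → x + (- 1#) * y ≈ 0# → x ≈ y
  x-y≈0⇒x≈y x y h = AG.x∙y⁻¹≈ε⇒x≈y x y (≈-trans (+-cong ≈-refl (≈-sym (R.-1*x≈-x y))) h)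

  x≈y⇒x-y≈0 : ∀ x y → x ≈ y → x + (- 1#) * y ≈ 0#
  x≈y⇒x-y≈0 x y h = ≈-trans (+-cong ≈-refl (R.-1*x≈-x y)) (AG.x≈y⇒x∙y⁻¹≈ε h)

  -1*[-1*x]≈x : ∀ x → (- 1#) * ((- 1#) * x) ≈ x
  -1*[-1*x]≈x x = ≈-trans (R.-1*x≈-x _) (≈-trans (-‿cong (R.-1*x≈-x x)) (AG.⁻¹-involutive x))

  telescope : ∀ a b d → (b + (- 1#) * d) + (- 1#) * (b + (- 1#) * a) ≈ a + (- 1#) * d
  telescope a b d = begin
    (b + (- 1#) * d) + (- 1#) * (b + (- 1#) * a)
      ≈⟨ +-cong (+-cong ≈-refl (R.-1*x≈-x d)) (≈-trans (R.-1*x≈-x _) (-‿cong (+-cong ≈-refl (R.-1*x≈-x a)))) ⟩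
    (b - d) + - (b - a)                           ≈⟨ +-cong ≈-refl (AG.⁻¹-anti-homo‿- b a) ⟩
    (b - d) + (a - b)                             ≈⟨ +-comm _ _ ⟩
    (a + - b) + (b + - d)                         ≈⟨ +-assoc _ _ _ ⟩
    a + (- b + (b + - d))                         ≈⟨ +-cong ≈-refl (+-assoc _ _ _) ⟨
    a + ((- b + b) + - d)                         ≈⟨ +-cong ≈-refl (+-cong (-‿inverseˡ b) ≈-refl) ⟩
    a + (0# + - d)                                ≈⟨ +-cong ≈-refl (+-identityˡ _) ⟩
    a + - d                                       ≈⟨ +-cong ≈-refl (R.-1*x≈-x d) ⟨
    a + (- 1#) * d                                ∎

  module _ {A : Set} where

    eval : List (Carrier × A) → (A → Carrier) → Carrier
    eval []            φ = 0#
    eval ((a , k) ∷ u) φ = a * φ k + eval u φ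

    eval-cong : ∀ u {φ ψ : A → Carrier} → (∀ k → φ k ≈ ψ k) → eval u φ ≈ eval u ψ
    eval-cong []            φ≈ψ = ≈-refl
    eval-cong ((a , k) ∷ u) φ≈ψ = +-cong (*-cong ≈-refl (φ≈ψ k)) (eval-cong u φ≈ψ)

    eval-++ : ∀ u w φ → eval (u ++ w) φ ≈ eval u φ + eval w φ
    eval-++ []            w φ = ≈-sym (+-identityˡ _)
    eval-++ ((a , k) ∷ u) w φ = ≈-trans (+-cong ≈-refl (eval-++ u w φ)) (≈-sym (+-assoc _ _ _))

    eval-scale : ∀ b u φ → eval (map (λ e → (b * proj₁ e , proj₂ e)) u) φ ≈ b * eval u φ
    eval-scale b []            φ = ≈-sym (zeroʳ b)
    eval-scale b ((a , k) ∷ u) φ =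
      ≈-trans (+-cong (*-assoc _ _ _) (eval-scale b u φ)) (≈-sym (distribˡ _ _ _))

    eval-+ : ∀ u φ ψ → eval u (λ k → φ k + ψ k) ≈ eval u φ + eval u ψ
    eval-+ []            φ ψ = ≈-sym (+-identityʳ _)
    eval-+ ((a , k) ∷ u) φ ψ =
      ≈-trans (+-cong (distribˡ _ _ _) (eval-+ u φ ψ)) (+CS.interchange _ _ _ _)

    eval-*ˡ : ∀ u b φ → eval u (λ k → b * φ k) ≈ b * eval u φ
    eval-*ˡ []            b φ = ≈-sym (zeroʳ b)
    eval-*ˡ ((a , k) ∷ u) b φ = begin
      a * (b * φ k) + eval u (λ k → b * φ k)  ≈⟨ +-cong (*CS.x∙yz≈y∙xz a b (φ k)) (eval-*ˡ u b φ) ⟩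
      b * (a * φ k) + b * eval u φ            ≈⟨ distribˡ b _ _ ⟨
      b * (a * φ k + eval u φ)                ∎

    eval-zero : ∀ u φ → (∀ k → φ k ≈ 0#) → eval u φ ≈ 0#
    eval-zero []            φ φ≈0 = ≈-refl
    eval-zero ((a , k) ∷ u) φ φ≈0 =
      ≈-trans (+-cong (≈-trans (*-cong ≈-refl (φ≈0 k)) (zeroʳ a)) (eval-zero u φ φ≈0)) (+-identityʳ 0#)

  sumOver : ∀ {A : Set} → List A → (A → Carrier) → Carrier
  sumOver []      φ = 0#
  sumOver (x ∷ l) φ = φ x + sumOver l φ

  eval-map-pair : ∀ {A : Set} w (l : List A) φ → eval (map (λ r → (w , r)) l) φ ≈ w * sumOver l φ
  eval-map-pair w []      φ = ≈-sym (zeroʳ w)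
  eval-map-pair w (r ∷ l) φ = ≈-trans (+-cong ≈-refl (eval-map-pair w l φ)) (≈-sym (distribˡ w _ _))

  sumOver-consIf : ∀ {A : Set} b (mk : T b → A) φ x → (∀ h → φ (mk h) ≈ x) →
                   sumOver (consIf b mk []) φ ≈ when b x
  sumOver-consIf true  mk φ x φmk≈x = ≈-trans (+-identityʳ _) (φmk≈x tt)
  sumOver-consIf false mk φ x _     = ≈-refl

  eval-consIf : ∀ {A : Set} b a (mk : T b → A) φ x → (∀ h → φ (mk h) ≈ x) →
                eval (consIf b (λ h → (a , mk h)) []) φ ≈ a * when b x
  eval-consIf true  a mk φ x φmk≈x = ≈-trans (+-identityʳ _) (*-cong ≈-refl (φmk≈x tt))
  eval-consIf false a mk φ x _     = ≈-sym (zeroʳ a)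

  module Classes {A : Set} (_∼_ : A → A → Bool) (∼-isEquivalence : IsEquivalence (λ a b → T (a ∼ b))) where
    open IsEquivalence ∼-isEquivalence renaming (refl to ∼-refl; sym to ∼-sym; trans to ∼-trans)

    classOf : A → A → Carrier
    classOf c k = ind (k ∼ c)

    removeClass : A → List (Carrier × A) → List (Carrier × A)
    removeClass c []            = []
    removeClass c ((a , k) ∷ u) = if k ∼ c then removeClass c u else (a , k) ∷ removeClass c u

    length-removeClass : ∀ c u → length (removeClass c u) ≤ length u
    length-removeClass c []            = z≤n
    length-removeClass c ((a , k) ∷ u) with k ∼ c
    ... | true  = m≤n⇒m≤1+n (length-removeClass c u)
    ... | false = s≤s (length-removeClass c u)

    length-removeClass-head : ∀ a c u → length (removeClass c ((a , c) ∷ u)) ≤ length u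
    length-removeClass-head a c u with c ∼ c in c∼c
    ... | true  = length-removeClass c u
    ... | false = ⊥-elim (≡false⇒¬T c∼c ∼-refl)

    eval-split : ∀ c u φ → (∀ {k} → T (k ∼ c) → φ k ≈ φ c) →
                 eval u φ ≈ eval u (classOf c) * φ c + eval (removeClass c u) φ
    eval-split c []            φ respects = ≈-sym (≈-trans (+-identityʳ _) (zeroˡ _))
    eval-split c ((a , k) ∷ u) φ respects with k ∼ c in k∼c
    ... | true = begin
      a * φ k + eval u φ              ≈⟨ +-cong (*-cong ≈-refl (respects (≡true⇒T k∼c))) (eval-split c u φ respects) ⟩
      a * φ c + (Σc * φ c + rest)     ≈⟨ +-assoc _ _ _ ⟨
      (a * φ c + Σc * φ c) + rest     ≈⟨ +-cong (distribʳ (φ c) a Σc) ≈-refl ⟨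
      (a + Σc) * φ c + rest           ≈⟨ +-cong (*-cong (+-cong (*-identityʳ a) ≈-refl) ≈-refl) ≈-refl ⟨
      (a * 1# + Σc) * φ c + rest      ∎
      where Σc   = eval u (classOf c)
            rest = eval (removeClass c u) φ
    ... | false = begin
      a * φ k + eval u φ                  ≈⟨ +-cong ≈-refl (eval-split c u φ respects) ⟩
      a * φ k + (Σc * φ c + rest)         ≈⟨ +CS.x∙yz≈y∙xz _ _ _ ⟩
      Σc * φ c + (a * φ k + rest)         ≈⟨ +-cong (*-cong a0+Σc≈Σc ≈-refl) ≈-refl ⟨
      (a * 0# + Σc) * φ c + (a * φ k + rest)  ∎
      where Σc       = eval u (classOf c)
            rest     = eval (removeClass c u) φ
            a0+Σc≈Σc = ≈-trans (+-cong (zeroʳ a) ≈-refl) (+-identityˡ Σc)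

    eval-removeClass-same : ∀ c d u → T (d ∼ c) → eval (removeClass c u) (classOf d) ≈ 0#
    eval-removeClass-same c d []            _   = ≈-refl
    eval-removeClass-same c d ((a , k) ∷ u) d∼c with k ∼ c in k∼c
    ... | true  = eval-removeClass-same c d u d∼c
    ... | false with k ∼ d in k∼d
    ...   | true  = ⊥-elim (≡false⇒¬T k∼c (∼-trans (≡true⇒T k∼d) d∼c))
    ...   | false = ≈-trans (+-cong (zeroʳ a) (eval-removeClass-same c d u d∼c)) (+-identityʳ 0#)

    eval-removeClass-other : ∀ c d u → ¬ T (d ∼ c) →
                             eval (removeClass c u) (classOf d) ≈ eval u (classOf d)
    eval-removeClass-other c d []            _   = ≈-refl
    eval-removeClass-other c d ((a , k) ∷ u) d≁c with k ∼ c in k∼c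
    ... | false = +-cong ≈-refl (eval-removeClass-other c d u d≁c)
    ... | true with k ∼ d in k∼d
    ...   | true  = ⊥-elim (d≁c (∼-trans (∼-sym (≡true⇒T k∼d)) (≡true⇒T k∼c)))
    ...   | false = ≈-sym (≈-trans (+-cong (zeroʳ a) (≈-sym (eval-removeClass-other c d u d≁c))) (+-identityˡ _))

    eval≈0-byClasses : ∀ u φ → (∀ {k k'} → T (k ∼ k') → φ k ≈ φ k') →
                       (∀ d → φ d ≈ 0# ⊎ eval u (classOf d) ≈ 0#) → eval u φ ≈ 0#
    eval≈0-byClasses u φ respects = go (length u) u ≤-refl
      where
        go : ∀ n u → length u ≤ n → (∀ d → φ d ≈ 0# ⊎ eval u (classOf d) ≈ 0#) → eval u φ ≈ 0#
        go n       []            _         H = ≈-refl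
        go (suc n) ((a , c) ∷ u) (s≤s len) H = begin
          eval U φ                                             ≈⟨ eval-split c U φ respects ⟩
          eval U (classOf c) * φ c + eval (removeClass c U) φ  ≈⟨ +-cong classOfHead rest ⟩
          0# + 0#                                              ≈⟨ +-identityʳ 0# ⟩
          0#                                                   ∎
          where
            U = (a , c) ∷ u
            classOfHead : eval U (classOf c) * φ c ≈ 0#
            classOfHead with H c
            ... | inj₁ φc≈0 = ≈-trans (*-cong ≈-refl φc≈0) (zeroʳ _)
            ... | inj₂ Σc≈0 = ≈-trans (*-cong Σc≈0 ≈-refl) (zeroˡ _)
            H′ : ∀ d → φ d ≈ 0# ⊎ eval (removeClass c U) (classOf d) ≈ 0#
            H′ d with H d | T? (d ∼ c)
            ... | inj₁ φd≈0 | _        = inj₁ φd≈0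
            ... | inj₂ _    | yes d∼c  = inj₂ (eval-removeClass-same c d U d∼c)
            ... | inj₂ Σd≈0 | no  d≁c  = inj₂ (≈-trans (eval-removeClass-other c d U d≁c) Σd≈0)
            rest : eval (removeClass c U) φ ≈ 0#
            rest = go n (removeClass c U) (≤-trans (length-removeClass-head a c u) len) H′

module Coefficients {c ℓ : Level} (K : Field c ℓ) (Γ : Graph) where
  open Field K renaming (refl to ≈-refl; sym to ≈-sym; trans to ≈-trans)
  open import Relation.Binary.Reasoning.Setoid setoid
  open FormalSums K
  open Graph Γ
  open Cycles Γ

  χ : List V → List V → Carrier
  χ z l = ind (isCyc Γ l ∧ sameCycle Γ l z)

  χ-rotN : ∀ z k l → χ z (rotN k l) ≡ χ z l
  χ-rotN z k l = cong ind (cong₂ _∧_ (isCyc-rotN-≡ k l) (sameCycle-rotN k l z))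

  coeffH-eval : ∀ u l → coeffH K Γ u l ≈ eval u (λ k → ind (sameList Γ (proj₁ k) l))
  coeffH-eval []                   l = ≈-refl
  coeffH-eval ((a , (kl , _)) ∷ u) l with sameList Γ kl l
  ... | true  = +-cong (≈-sym (*-identityʳ a)) (coeffH-eval u l)
  ... | false = ≈-trans (coeffH-eval u l)
                        (≈-sym (≈-trans (+-cong (zeroʳ a) ≈-refl) (+-identityˡ _)))

  coeffC-consIf : ∀ b a kl (mk : T b → T (isCyc Γ kl)) rest z →
                  coeffC K Γ (consIf b (λ p → (a , (kl , mk p))) rest) z
                    ≈ a * ind (b ∧ sameCycle Γ kl z) + coeffC K Γ rest z
  coeffC-consIf false a kl mk rest z = ≈-sym (≈-trans (+-cong (zeroʳ a) ≈-refl) (+-identityˡ _))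
  coeffC-consIf true  a kl mk rest z with sameCycle Γ kl z
  ... | true  = +-cong (≈-sym (*-identityʳ a)) ≈-refl
  ... | false = ≈-sym (≈-trans (+-cong (zeroʳ a) ≈-refl) (+-identityˡ _))

  coeffC-close : ∀ u z → coeffC K Γ (close K Γ u) z ≈ eval u (χ z ∘ proj₁)
  coeffC-close []                   z = ≈-refl
  coeffC-close ((a , (kl , _)) ∷ u) z =
    ≈-trans (coeffC-consIf (isCyc Γ kl) a kl (λ p → p) (close K Γ u) z) (+-cong ≈-refl (coeffC-close u z))

  _⊖_ : HVec K Γ → HVec K Γ → HVec K Γ
  u ⊖ w = u ++ scaleH K (- 1#) w

  eval-⊖ : ∀ u w φ → eval (u ⊖ w) φ ≈ eval u φ + (- 1#) * eval w φ
  eval-⊖ u w φ = ≈-trans (eval-++ u _ φ) (+-cong ≈-refl (eval-scale (- 1#) w φ))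

  samePath-isEquivalence : IsEquivalence (λ (k k' : HamPath Γ) → T (sameList Γ (proj₁ k) (proj₁ k')))
  samePath-isEquivalence = record
    { refl  = λ {k} → sameList-refl (proj₁ k)
    ; sym   = λ {k} {k'} p → subst (λ m → T (sameList Γ m (proj₁ k))) (sameList⇒≡ (proj₁ k) (proj₁ k') p)
                                   (sameList-refl (proj₁ k))
    ; trans = λ {k} {k'} {k''} p q → subst (λ m → T (sameList Γ (proj₁ k) m))
                                           (sameList⇒≡ (proj₁ k') (proj₁ k'') q) p
    }

  sameCycle-isEquivalence : IsEquivalence (λ (k k' : HamPath Γ) → T (sameCycle Γ (proj₁ k) (proj₁ k')))
  sameCycle-isEquivalence = record
    { refl  = λ {k} → sameCycle-refl (proj₁ k)
    ; sym   = λ {k} {k'} → sameCycle-sym {proj₁ k} {proj₁ k'}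
    ; trans = λ {k} {k'} {k''} → sameCycle-trans {proj₁ k} {proj₁ k'} {proj₁ k''}
    }

  module SamePath  = Classes (λ k k' → sameList Γ (proj₁ k) (proj₁ k')) samePath-isEquivalence
  module SameCycle = Classes (λ k k' → sameCycle Γ (proj₁ k) (proj₁ k')) sameCycle-isEquivalence

  ≈H⇒eval≈ : ∀ u w → _≈H_ K u w → ∀ (f : List V → Carrier) → eval u (f ∘ proj₁) ≈ eval w (f ∘ proj₁)
  ≈H⇒eval≈ u w u≈w f = x-y≈0⇒x≈y _ _ (begin
    eval u (f ∘ proj₁) + (- 1#) * eval w (f ∘ proj₁)  ≈⟨ eval-⊖ u w _ ⟨
    eval (u ⊖ w) (f ∘ proj₁)                          ≈⟨ SamePath.eval≈0-byClasses (u ⊖ w) (f ∘ proj₁)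
                                                           (λ {k} {k'} p → ≡⇒≈ (cong f (sameList⇒≡ _ _ p)))
                                                           (λ d → inj₂ (coefficient≈0 d)) ⟩
    0#                                                ∎)
    where
      coefficient≈0 : ∀ d → eval (u ⊖ w) (SamePath.classOf d) ≈ 0#
      coefficient≈0 d = ≈-trans (eval-⊖ u w _) (x≈y⇒x-y≈0 _ _
        (≈-trans (≈-sym (coeffH-eval u (proj₁ d))) (≈-trans (u≈w d) (coeffH-eval w (proj₁ d)))))

  close≈0⇒eval-χ≈0 : ∀ u → _≈C_ K (close K Γ u) [] → ∀ (z : CycRep Γ) → eval u (χ (proj₁ z) ∘ proj₁) ≈ 0#
  close≈0⇒eval-χ≈0 u close≈0 z = ≈-trans (≈-sym (coeffC-close u (proj₁ z))) (close≈0 z)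

  eval-χ≈0⇒close≈0 : ∀ u → (∀ (z : CycRep Γ) → eval u (χ (proj₁ z) ∘ proj₁) ≈ 0#) → _≈C_ K (close K Γ u) []
  eval-χ≈0⇒close≈0 u eval≈0 z = ≈-trans (coeffC-close u (proj₁ z)) (eval≈0 z)

  close≈0-++ : ∀ u w → _≈C_ K (close K Γ u) [] → _≈C_ K (close K Γ w) [] → _≈C_ K (close K Γ (u ++ w)) []
  close≈0-++ u w u≈0 w≈0 = eval-χ≈0⇒close≈0 (u ++ w) λ z →
    ≈-trans (eval-++ u w _) (≈-trans (+-cong (close≈0⇒eval-χ≈0 u u≈0 z) (close≈0⇒eval-χ≈0 w w≈0 z)) (+-identityʳ 0#))

  close≈0-scale : ∀ a u → _≈C_ K (close K Γ u) [] → _≈C_ K (close K Γ (scaleH K a u)) []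
  close≈0-scale a u u≈0 = eval-χ≈0⇒close≈0 (scaleH K a u) λ z →
    ≈-trans (eval-scale a u _) (≈-trans (*-cong ≈-refl (close≈0⇒eval-χ≈0 u u≈0 z)) (zeroʳ a))

  close≈0-≈H : ∀ u w → _≈H_ K u w → _≈C_ K (close K Γ u) [] → _≈C_ K (close K Γ w) []
  close≈0-≈H u w u≈w u≈0 = eval-χ≈0⇒close≈0 w λ z →
    ≈-trans (≈-sym (≈H⇒eval≈ u w u≈w _)) (close≈0⇒eval-χ≈0 u u≈0 z)

  VanishesOffCycles : (List V → Carrier) → Set ℓ
  VanishesOffCycles f = ∀ (k : HamPath Γ) → ¬ T (isCyc Γ (proj₁ k)) → f (proj₁ k) ≈ 0#

  RotationInvariant : (List V → Carrier) → Set ℓ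
  RotationInvariant f = ∀ l → T (isCyc Γ l) → f (rot l) ≈ f l

  -- The sums of the coefficients of u over cycle classes are the coefficients of close u.
  close≈0⇒eval≈0 : ∀ u f → VanishesOffCycles f → RotationInvariant f →
                   _≈C_ K (close K Γ u) [] → eval u (f ∘ proj₁) ≈ 0#
  close≈0⇒eval≈0 u f off inv close≈0 =
    SameCycle.eval≈0-byClasses u (f ∘ proj₁) (λ {k} {k'} → respects {k} {k'}) classSum≈0
    where
      inv-rotN : ∀ j l → T (isCyc Γ l) → f (rotN j l) ≈ f l
      inv-rotN zero    l c = ≈-refl
      inv-rotN (suc j) l c = ≈-trans (inv-rotN j (rot l) (isCyc-rot l c)) (inv l c)

      respects : ∀ {k k' : HamPath Γ} → T (sameCycle Γ (proj₁ k) (proj₁ k')) → f (proj₁ k) ≈ f (proj₁ k')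
      respects {k} {k'} p with sameCycle⇒rotN (proj₁ k) (proj₁ k') p | T? (isCyc Γ (proj₁ k))
      ... | j , _ , eq | yes c  = ≈-sym (≈-trans (≡⇒≈ (cong f (sym eq))) (inv-rotN j (proj₁ k) c))
      ... | _ , _ , _  | no nc =
        ≈-trans (off k nc) (≈-sym (off k' (λ c' → nc (subst T (sym (sameCycle⇒isCyc-≡ {proj₁ k} p)) c'))))

      classSum≈0 : ∀ d → f (proj₁ d) ≈ 0# ⊎ eval u (SameCycle.classOf d) ≈ 0#
      classSum≈0 d with T? (isCyc Γ (proj₁ d))
      ... | no nc = inj₁ (off d nc)
      ... | yes c = inj₂ (begin
        eval u (SameCycle.classOf d)        ≈⟨ eval-cong u (λ k → ≡⇒≈ (cong ind (classOf≡χ k))) ⟩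
        eval u (χ (proj₁ d) ∘ proj₁)        ≈⟨ coeffC-close u (proj₁ d) ⟨
        coeffC K Γ (close K Γ u) (proj₁ d)  ≈⟨ close≈0 (proj₁ d , c) ⟩
        0#                                  ∎)
        where
          classOf≡χ : ∀ (k : HamPath Γ) → sameCycle Γ (proj₁ k) (proj₁ d)
                                          ≡ (isCyc Γ (proj₁ k) ∧ sameCycle Γ (proj₁ k) (proj₁ d))
          classOf≡χ k = T-ext (λ p → ∧⁺ (subst T (sym (sameCycle⇒isCyc-≡ {proj₁ k} p)) c) p) (∧⁻ʳ {isCyc Γ (proj₁ k)})

module Substitution {c ℓ : Level} (K : Field c ℓ) (Γ : Graph) (G : Tube Γ) where
  open Graph Γ
  open Tube G using (mem)
  open Cycles Γ
  private
    Δ = contract Γ G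
    R = restrict Γ G
    module Δ = Cycles Δ

  sub : List (VC Γ G) → List (Sub mem) → List V
  sub = substitute K Γ G

  chain⇒rightOK : ∀ q r → T (chain Γ (map proj₁ q ++ sub r q)) → T (rightOK K Γ G (map proj₁ q) r)
  chain⇒rightOK []       r                   c = tt
  chain⇒rightOK (q₁ ∷ q) []                  c = tt
  chain⇒rightOK (q₁ ∷ q) (nothing ∷ r)       c = tt
  chain⇒rightOK (q₁ ∷ q) (just (v , _) ∷ r)  c = chain⇒adj-lastOf (proj₁ q₁) (map proj₁ q) v (sub r (q₁ ∷ q)) c

  chain⇒junctions-after : ∀ u p q → T (chain Γ (u ∷ sub p q)) → T (junctions K Γ G (just u) p (map proj₁ q))
  chain⇒junctions-after u []                  q        c = tt
  chain⇒junctions-after u (nothing ∷ r)       []       c =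
    ∧⁺ {leftOK K Γ G (just u) []} tt (chain⇒rightOK [] r (chain-tail u (sub r []) c))
  chain⇒junctions-after u (nothing ∷ r)       (q₁ ∷ q) c =
    ∧⁺ {adj u (proj₁ q₁)} (∧⁻ˡ c) (chain⇒rightOK (q₁ ∷ q) r (chain-tail u (map proj₁ (q₁ ∷ q) ++ sub r (q₁ ∷ q)) c))
  chain⇒junctions-after u (just (v , _) ∷ r)  q        c = chain⇒junctions-after v r q (chain-tail u (v ∷ sub r q) c)

  -- The junction test in composeB is redundant: it holds whenever the substituted list is a path.
  chain⇒junctions : ∀ p q → T (chain Γ (sub p q)) → T (junctions K Γ G nothing p (map proj₁ q))
  chain⇒junctions []                  q c = tt
  chain⇒junctions (nothing ∷ r)       q c = chain⇒rightOK q r c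
  chain⇒junctions (just (v , _) ∷ r)  q c = chain⇒junctions-after v r q c

  sub-++ : ∀ a b q → sub (a ++ b) q ≡ sub a q ++ sub b q
  sub-++ []                 b q = refl
  sub-++ (nothing ∷ a)      b q =
    trans (cong (map proj₁ q ++_) (sub-++ a b q)) (sym (++-assoc (map proj₁ q) (sub a q) (sub b q)))
  sub-++ (just (v , _) ∷ a) b q = cong (v ∷_) (sub-++ a b q)

  sub-rot : ∀ p q → Σ ℕ (λ k → sub (rot1 Δ p) q ≡ rotN k (sub p q))
  sub-rot []                 q = 0 , refl
  sub-rot (nothing ∷ r)      q = length (map proj₁ q) ,
    trans (sub-++ r (nothing ∷ []) q)
          (trans (cong (sub r q ++_) (++-identityʳ (map proj₁ q))) (sym (rotN-++ (map proj₁ q) (sub r q))))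
  sub-rot (just (v , h) ∷ r) q = 1 , sub-++ r (just (v , h) ∷ []) q

  adj⇒touches : ∀ u v → T (mem u) → T (adj u v) → T (touches Γ G v)
  adj⇒touches u v u∈G u~v = any-intro (λ w → mem w ∧ adj w v) enum (∧⁺ u∈G u~v) (enum-complete u)

  lastOf-map-proj₁ : ∀ (a : Sub mem) l → lastOf Γ (proj₁ a) (map proj₁ l) ≡ proj₁ (lastOf R a l)
  lastOf-map-proj₁ a []      = refl
  lastOf-map-proj₁ a (b ∷ l) = lastOf-map-proj₁ b l

  length-sub : ∀ p q₁ q → length p ≤ length (sub p (q₁ ∷ q))
  length-sub []                q₁ q = z≤n
  length-sub (nothing ∷ r)     q₁ q = s≤s (≤-trans (length-sub r q₁ q) (length-++-≤ʳ (sub r (q₁ ∷ q)) {map proj₁ q}))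
  length-sub (just _ ∷ r)      q₁ q = s≤s (length-sub r q₁ q)

  -- The two ends of sub p q lie in the blocks of the two ends of p, so a closing edge of
  -- sub p q joins these blocks in Γ/G.
  closing-edge : ∀ x i y q₁ q → T (isHam Δ (x ∷ i ++ y ∷ [])) →
                 T (endsAdj Γ (sub (x ∷ i ++ y ∷ []) (q₁ ∷ q))) → T (Graph.adj Δ y x)
  closing-edge (just (v , _)) i (just (v' , h')) q₁ q _ e = subst (λ w → T (adj w v)) last≡v' e
    where last≡v' : lastOf Γ v (sub (i ++ just (v' , h') ∷ []) (q₁ ∷ q)) ≡ v'
          last≡v' = trans (cong (lastOf Γ v) (sub-++ i _ (q₁ ∷ q))) (lastOf-snoc v (sub i (q₁ ∷ q)) v')
  closing-edge nothing i (just (v' , h')) q₁ q _ e =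
    adj⇒touches (proj₁ q₁) v' (proj₂ q₁) (adj-symᵀ (subst (λ w → T (adj w (proj₁ q₁))) last≡v' e))
    where last≡v' : lastOf Γ (proj₁ q₁) (map proj₁ q ++ sub (i ++ just (v' , h') ∷ []) (q₁ ∷ q)) ≡ v'
          last≡v' = begin
            lastOf Γ (proj₁ q₁) (map proj₁ q ++ sub (i ++ just (v' , h') ∷ []) (q₁ ∷ q))
              ≡⟨ cong (λ t → lastOf Γ (proj₁ q₁) (map proj₁ q ++ t)) (sub-++ i _ (q₁ ∷ q)) ⟩
            lastOf Γ (proj₁ q₁) (map proj₁ q ++ sub i (q₁ ∷ q) ++ v' ∷ [])
              ≡⟨ cong (lastOf Γ (proj₁ q₁)) (sym (++-assoc (map proj₁ q) (sub i (q₁ ∷ q)) (v' ∷ []))) ⟩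
            lastOf Γ (proj₁ q₁) ((map proj₁ q ++ sub i (q₁ ∷ q)) ++ v' ∷ [])
              ≡⟨ lastOf-snoc (proj₁ q₁) (map proj₁ q ++ sub i (q₁ ∷ q)) v' ⟩
            v' ∎
            where open Relation.Binary.PropositionalEquality.≡-Reasoning
  closing-edge (just (v , _)) i nothing q₁ q _ e =
    adj⇒touches (proj₁ (lastOf R q₁ q)) v (proj₂ (lastOf R q₁ q)) (subst (λ w → T (adj w v)) last∈G e)
    where last∈G : lastOf Γ v (sub (i ++ nothing ∷ []) (q₁ ∷ q)) ≡ proj₁ (lastOf R q₁ q)
          last∈G = trans (cong (lastOf Γ v) (sub-++ i _ (q₁ ∷ q)))
                   (trans (lastOf-++ v (sub i (q₁ ∷ q)) (proj₁ q₁) (map proj₁ q ++ []))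
                   (trans (cong (lastOf Γ (proj₁ q₁)) (++-identityʳ (map proj₁ q))) (lastOf-map-proj₁ q₁ q)))
  closing-edge nothing i nothing q₁ q hp _ =
    Δ.count≡0⇒∉ nothing (i ++ nothing ∷ [])
      (suc-injective (trans (sym (Δ.count-head nothing (i ++ nothing ∷ [])))
                            (Δ.isHam⇒count≡1 (nothing ∷ i ++ nothing ∷ []) nothing hp)))
      (∈-++⁺ʳ i (here refl))

  isCyc-sub⇒isCyc : ∀ p q → T (isHam Δ p) → T (isHam R q) → T (isCyc Γ (sub p q)) → T (isCyc Δ p)
  isCyc-sub⇒isCyc []                q        hp hq _ = ∧⁺ hp tt
  isCyc-sub⇒isCyc (x ∷ [])          q        hp hq _ = ∧⁺ hp tt
  isCyc-sub⇒isCyc (x ∷ y ∷ [])      q        hp hq _ = ∧⁺ hp tt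
  isCyc-sub⇒isCyc (x ∷ y ∷ z ∷ r)   []       hp hq _ with Cycles.isHam⇒count≡1 R [] (Tube.nonempty G) hq
  ... | ()
  isCyc-sub⇒isCyc (x ∷ y ∷ z ∷ r)   (q₁ ∷ q) hp hq cyc with ∨⁻ {length s ≤ᵇ 2} (∧⁻ʳ {isHam Γ s} cyc)
    where s = sub (x ∷ y ∷ z ∷ r) (q₁ ∷ q)
  ... | inj₂ ends = ∧⁺ hp (∨⁺ʳ {length (x ∷ y ∷ z ∷ r) ≤ᵇ 2} (endsAdj-sub⇒endsAdj x (y ∷ z ∷ r) q₁ q (λ ()) hp ends))
    where
      endsAdj-sub⇒endsAdj : ∀ x rest q₁ q → rest ≢ [] → T (isHam Δ (x ∷ rest)) →
                            T (endsAdj Γ (sub (x ∷ rest) (q₁ ∷ q))) → T (endsAdj Δ (x ∷ rest))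
      endsAdj-sub⇒endsAdj x rest q₁ q ne hp e with initLast rest
      ... | []       = ⊥-elim (ne refl)
      ... | i ∷ʳ′ w = subst (λ t → T (Graph.adj Δ t x)) (sym (Δ.lastOf-snoc x i w)) (closing-edge x i w q₁ q hp e)
  ... | inj₁ short with ≤-trans (length-sub (x ∷ y ∷ z ∷ r) q₁ q) (≤ᵇ⇒≤ _ 2 short)
  ...   | s≤s (s≤s ())

module Composition {c ℓ : Level} (K : Field c ℓ) (Γ : Graph) (G : Tube Γ) where
  open Field K renaming (refl to ≈-refl; sym to ≈-sym; trans to ≈-trans)
  open import Relation.Binary.Reasoning.Setoid setoid
  open Graph Γ
  open FormalSums K
  open Substitution K Γ G
  private
    Δ = contract Γ G
    R = restrict Γ G
    module Γ = Coefficients K Γ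
    module Δ = Coefficients K Δ

  eval-compose : ∀ m x φ → eval (compose K Γ G m x) φ
                           ≈ eval m (λ P → eval x (λ Q → sumOver (composeB K Γ G P Q) φ))
  eval-compose []            x φ = ≈-refl
  eval-compose ((a , P) ∷ m) x φ =
    ≈-trans (eval-++ (inner x) (compose K Γ G m x) φ) (+-cong (eval-inner x) (eval-compose m x φ))
    where
      inner : HVec K R → HVec K Γ
      inner x = concatMap (λ f → map (λ r → (a * proj₁ f , r)) (composeB K Γ G P (proj₂ f))) x
      eval-inner : ∀ x → eval (inner x) φ ≈ a * eval x (λ Q → sumOver (composeB K Γ G P Q) φ)
      eval-inner []            = ≈-sym (zeroʳ a)
      eval-inner ((b , Q) ∷ x) = begin
        eval (map (λ r → (a * b , r)) (composeB K Γ G P Q) ++ inner x) φ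
          ≈⟨ eval-++ (map (λ r → (a * b , r)) (composeB K Γ G P Q)) (inner x) φ ⟩
        eval (map (λ r → (a * b , r)) (composeB K Γ G P Q)) φ + eval (inner x) φ
          ≈⟨ +-cong (eval-map-pair (a * b) (composeB K Γ G P Q) φ) (eval-inner x) ⟩
        (a * b) * sumOver (composeB K Γ G P Q) φ + a * eval x (λ Q → sumOver (composeB K Γ G P Q) φ)
          ≈⟨ +-cong (*-assoc _ _ _) ≈-refl ⟩
        a * (b * sumOver (composeB K Γ G P Q) φ) + a * eval x (λ Q → sumOver (composeB K Γ G P Q) φ)
          ≈⟨ distribˡ a _ _ ⟨
        a * (b * sumOver (composeB K Γ G P Q) φ + eval x (λ Q → sumOver (composeB K Γ G P Q) φ)) ∎

  sumOver-composeB : ∀ (P : HamPath Δ) (Q : HamPath R) f →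
    sumOver (composeB K Γ G P Q) (f ∘ proj₁) ≈ when (isHam Γ (sub (proj₁ P) (proj₁ Q))) (f (sub (proj₁ P) (proj₁ Q)))
  sumOver-composeB (p , _) (q , _) f with junctions K Γ G nothing p (map proj₁ q) in junctions≡
  ... | true  = sumOver-consIf (isHam Γ (sub p q)) (λ h → (sub p q , h)) (f ∘ proj₁) (f (sub p q)) (λ _ → ≈-refl)
  ... | false with T? (isHam Γ (sub p q))
  ...   | yes h  = ⊥-elim (≡false⇒¬T junctions≡ (chain⇒junctions p q (∧⁻ʳ {all _ enum} h)))
  ...   | no nh  = ≈-sym (when-¬T (f (sub p q)) nh)

  close-compose≈0 : ∀ m x → _≈C_ K (close K Δ m) [] → _≈C_ K (close K Γ (compose K Γ G m x)) []
  close-compose≈0 m x close≈0 (z , _) = begin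
    coeffC K Γ (close K Γ (compose K Γ G m x)) z
      ≈⟨ Γ.coeffC-close (compose K Γ G m x) z ⟩
    eval (compose K Γ G m x) (Γ.χ z ∘ proj₁)
      ≈⟨ eval-compose m x _ ⟩
    eval m (λ P → eval x (λ Q → sumOver (composeB K Γ G P Q) (Γ.χ z ∘ proj₁)))
      ≈⟨ eval-cong m (λ P → eval-cong x (closes P)) ⟩
    eval m (f ∘ proj₁)
      ≈⟨ Δ.close≈0⇒eval≈0 m f off inv close≈0 ⟩
    0# ∎
    where
      f : List (VC Γ G) → Carrier
      f p = eval x (λ Q → Γ.χ z (sub p (proj₁ Q)))

      closes : ∀ P Q → sumOver (composeB K Γ G P Q) (Γ.χ z ∘ proj₁) ≈ Γ.χ z (sub (proj₁ P) (proj₁ Q))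
      closes P Q = ≈-trans (sumOver-composeB P Q (Γ.χ z))
                           (when-ind (isHam Γ (sub (proj₁ P) (proj₁ Q))) _ (λ c → ∧⁻ˡ (∧⁻ˡ c)))

      off : Δ.VanishesOffCycles f
      off (p , hp) nc = eval-zero x _ λ Q →
        ≡⇒≈ (cong ind (¬T⇒≡false λ c → nc (isCyc-sub⇒isCyc p (proj₁ Q) hp (proj₂ Q) (∧⁻ˡ c))))

      inv : Δ.RotationInvariant f
      inv p _ = eval-cong x λ Q → ≡⇒≈ (χ-sub-rot (proj₁ Q))
        where χ-sub-rot : ∀ q → Γ.χ z (sub (rot1 Δ p) q) ≡ Γ.χ z (sub p q)
              χ-sub-rot q with sub-rot p q
              ... | k , eq = trans (cong (Γ.χ z) eq) (Γ.χ-rotN z k (sub p q))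

module Relabelling {c ℓ : Level} (K : Field c ℓ) {Γ Δ : Graph} (σ : Iso Γ Δ) where
  open Field K renaming (refl to ≈-refl; sym to ≈-sym; trans to ≈-trans)
  open import Relation.Binary.Reasoning.Setoid setoid
  open FormalSums K
  open Iso σ
  private
    module Γ = Coefficients K Γ
    module Δ = Coefficients K Δ

  eval-relabel : ∀ u (f : List (Graph.V Δ) → Carrier) →
    eval (relabel K σ u) (f ∘ proj₁) ≈ eval u (λ k → when (isHam Δ (map to (proj₁ k))) (f (map to (proj₁ k))))
  eval-relabel []                  f = ≈-refl
  eval-relabel ((a , (l , _)) ∷ u) f =
    ≈-trans (eval-++ (consIf (isHam Δ (map to l)) (λ h → (a , (map to l , h))) []) (relabel K σ u) (f ∘ proj₁))
            (+-cong (eval-consIf (isHam Δ (map to l)) a (λ h → (map to l , h)) (f ∘ proj₁) (f (map to l)) (λ _ → ≈-refl))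
                    (eval-relabel u f))

  lastOf-map : ∀ x r → lastOf Δ (to x) (map to r) ≡ to (lastOf Γ x r)
  lastOf-map x []      = refl
  lastOf-map x (y ∷ r) = lastOf-map y r

  map-rot : ∀ l → map to (rot1 Γ l) ≡ rot1 Δ (map to l)
  map-rot []      = refl
  map-rot (x ∷ r) = map-++ to r (x ∷ [])

  endsAdj-map : ∀ l → endsAdj Δ (map to l) ≡ endsAdj Γ l
  endsAdj-map []      = refl
  endsAdj-map (x ∷ r) = trans (cong (λ w → Graph.adj Δ w (to x)) (lastOf-map x r)) (adj-pres (lastOf Γ x r) x)

  isCyc-map⇒isCyc : ∀ l → T (isHam Γ l) → T (isCyc Δ (map to l)) → T (isCyc Γ l)
  isCyc-map⇒isCyc l hl c with ∨⁻ {length (map to l) ≤ᵇ 2} (∧⁻ʳ {isHam Δ (map to l)} c)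
  ... | inj₁ short = ∧⁺ hl (∨⁺ˡ (subst (λ n → T (n ≤ᵇ 2)) (length-map to l) short))
  ... | inj₂ ends  = ∧⁺ hl (∨⁺ʳ {length l ≤ᵇ 2} (subst T (endsAdj-map l) ends))

  close-relabel≈0 : ∀ u → _≈C_ K (close K Γ u) [] → _≈C_ K (close K Δ (relabel K σ u)) []
  close-relabel≈0 u close≈0 (z , _) = begin
    coeffC K Δ (close K Δ (relabel K σ u)) z                                  ≈⟨ Δ.coeffC-close (relabel K σ u) z ⟩
    eval (relabel K σ u) (Δ.χ z ∘ proj₁)                                      ≈⟨ eval-relabel u (Δ.χ z) ⟩
    eval u (λ k → when (isHam Δ (map to (proj₁ k))) (f (proj₁ k)))            ≈⟨ eval-cong u closes ⟩
    eval u (f ∘ proj₁)                                                        ≈⟨ Γ.close≈0⇒eval≈0 u f off inv close≈0 ⟩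
    0#                                                                        ∎
    where
      f : List (Graph.V Γ) → Carrier
      f l = Δ.χ z (map to l)

      closes : ∀ k → when (isHam Δ (map to (proj₁ k))) (f (proj₁ k)) ≈ f (proj₁ k)
      closes k = when-ind (isHam Δ (map to (proj₁ k))) _ (λ c → ∧⁻ˡ (∧⁻ˡ c))

      off : Γ.VanishesOffCycles f
      off (l , hl) nc = ≡⇒≈ (cong ind (¬T⇒≡false λ c → nc (isCyc-map⇒isCyc l hl (∧⁻ˡ c))))

      inv : Γ.RotationInvariant f
      inv l _ = ≡⇒≈ (trans (cong (Δ.χ z) (map-rot l)) (Δ.χ-rotN z 1 (map to l)))

module SubmoduleInKernel {c ℓ : Level} (K : Field c ℓ) where
  open Field K renaming (refl to ≈-refl; sym to ≈-sym; trans to ≈-trans)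
  open import Relation.Binary.Reasoning.Setoid setoid
  open FormalSums K

  close-relation≈0 : _≈C_ K (close K P₂ (relation K)) []
  close-relation≈0 (z , _) = begin
    coeffC K P₂ (close K P₂ (relation K)) z             ≈⟨ P.coeffC-close (relation K) z ⟩
    1# * x + ((- 1#) * P.χ z (proj₁ ν⁽¹²⁾) + 0#)         ≈⟨ +-cong ≈-refl (+-identityʳ _) ⟩
    1# * x + (- 1#) * P.χ z (proj₁ ν⁽¹²⁾)                ≈⟨ +-cong (*-identityˡ x) (*-cong ≈-refl ν⁽¹²⁾-closes-like-ν) ⟩
    x + (- 1#) * x                                     ≈⟨ x≈y⇒x-y≈0 x x ≈-refl ⟩
    0#                                                 ∎
    where
      module P = Coefficients K P₂
      x = P.χ z (proj₁ ν)
      -- ν⁽¹²⁾ is the rotation of ν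
      ν⁽¹²⁾-closes-like-ν : P.χ z (proj₁ ν⁽¹²⁾) ≈ x
      ν⁽¹²⁾-closes-like-ν = ≡⇒≈ (P.χ-rotN z 1 (proj₁ ν))

  close≈0-of-InSub : ∀ {Γ u} → InSub K Γ u → _≈C_ K (close K Γ u) []
  close≈0-of-InSub gen                          = close-relation≈0
  close≈0-of-InSub zero                         = λ _ → ≈-refl
  close≈0-of-InSub {Γ} (add {u = u} {w} p q)    = Coefficients.close≈0-++ K Γ u w (close≈0-of-InSub p) (close≈0-of-InSub q)
  close≈0-of-InSub {Γ} (scale {u = u} a p)      = Coefficients.close≈0-scale K Γ a u (close≈0-of-InSub p)
  close≈0-of-InSub {Γ} (resp {u = u} {w} u≈w p) = Coefficients.close≈0-≈H K Γ u w u≈w (close≈0-of-InSub p)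
  close≈0-of-InSub (iso {u = u} σ p)            = Relabelling.close-relabel≈0 K σ u (close≈0-of-InSub p)
  close≈0-of-InSub (act {Γ} G {m} p x)          = Composition.close-compose≈0 K Γ G m x (close≈0-of-InSub p)

module Walks (Γ : Graph) (S : Graph.V Γ → Bool) where
  open Graph Γ

  walk-start : ∀ {u w} → Walk Γ S u w → T (S u)
  walk-start (here s)     = s
  walk-start (step s _ _) = s

  walk-++ : ∀ {u v w} → Walk Γ S u v → Walk Γ S v w → Walk Γ S u w
  walk-++ (here _)       w₂ = w₂
  walk-++ (step s a w₁)  w₂ = step s a (walk-++ w₁ w₂)

  walk-reverse : ∀ {u w} → Walk Γ S u w → Walk Γ S w u
  walk-reverse (here s) = here s
  walk-reverse {u} (step {v = v} s a w) =
    walk-++ (walk-reverse w) (step (walk-start w) (subst T (adj-sym u v) a) (here s))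

  chain⇒walk : ∀ y rest → T (chain Γ (y ∷ rest)) → (∀ v → v ∈ y ∷ rest → T (S v)) →
               ∀ w → w ∈ y ∷ rest → Walk Γ S y w
  chain⇒walk y rest       c inS .y (here refl) = here (inS y (here refl))
  chain⇒walk y (z ∷ rest) c inS w  (there w∈) =
    step (inS y (here refl)) (∧⁻ˡ c) (chain⇒walk z rest (∧⁻ʳ {adj y z} c) (λ v v∈ → inS v (there v∈)) w w∈)

-- For a Hamiltonian path v₁ v₂ … vₙ the vertices other than v₁ form a tube G, with Γ/G ≅ P₂.
module TailTube (Γ : Graph) (v₁ v₂ : Graph.V Γ) (r : List (Graph.V Γ)) (hp : T (isHam Γ (v₁ ∷ v₂ ∷ r))) where
  open Graph Γ
  open Cycles Γ

  inTail : V → Bool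
  inTail v = not (does (v ≟ v₁))

  tail-count-v₁ : count Γ v₁ (v₂ ∷ r) ≡ 0
  tail-count-v₁ = suc-injective (trans (sym (count-head v₁ (v₂ ∷ r))) (isHam⇒count≡1 (v₁ ∷ v₂ ∷ r) v₁ hp))

  ∈tail⇒inTail : ∀ v → v ∈ v₂ ∷ r → T (inTail v)
  ∈tail⇒inTail v v∈ with v ≟ v₁
  ... | yes refl = count≡0⇒∉ v₁ (v₂ ∷ r) tail-count-v₁ v∈
  ... | no  _    = tt

  inTail⇒count≡1 : ∀ v → T (inTail v) → count Γ v (v₂ ∷ r) ≡ 1
  inTail⇒count≡1 v v∈G with v ≟ v₁
  ... | yes _   = ⊥-elim v∈G
  ... | no v≢v₁ = trans (sym (count-≢ v v₁ (v₂ ∷ r) v≢v₁)) (isHam⇒count≡1 (v₁ ∷ v₂ ∷ r) v hp)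

  inTail⇒∈tail : ∀ v → T (inTail v) → v ∈ v₂ ∷ r
  inTail⇒∈tail v v∈G = count≢0⇒∈ v (v₂ ∷ r) λ c≡0 → 1+n≢0 (trans (sym (inTail⇒count≡1 v v∈G)) c≡0)

  tail-chain : T (chain Γ (v₂ ∷ r))
  tail-chain = ∧⁻ʳ {adj v₁ v₂} (∧⁻ʳ {all _ enum} hp)

  open Walks Γ inTail

  G : Tube Γ
  G = record
    { mem       = inTail
    ; nonempty  = v₂ , ∈tail⇒inTail v₂ (here refl)
    ; connected = λ u w u∈G w∈G → walk-++ (walk-reverse (along u u∈G)) (along w w∈G)
    }
    where along : ∀ w → T (inTail w) → Walk Γ inTail v₂ w
          along w w∈G = chain⇒walk v₂ r tail-chain ∈tail⇒inTail w (inTail⇒∈tail w w∈G)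

  private
    Δ = contract Γ G
    R = restrict Γ G

  v₁′ : Sub (λ v → not (inTail v))
  v₁′ = v₁ , v₁∉G
    where v₁∉G : T (not (inTail v₁))
          v₁∉G with v₁ ≟ v₁
          ... | yes _   = tt
          ... | no v≢v = v≢v refl

  outside⇒≡v₁ : ∀ v → T (not (inTail v)) → v ≡ v₁
  outside⇒≡v₁ v v∉G with v ≟ v₁
  ... | yes v≡v₁ = v≡v₁
  ... | no  _    = ⊥-elim v∉G

  outside≡v₁′ : ∀ (y : Sub (λ v → not (inTail v))) → y ≡ v₁′
  outside≡v₁′ (v , h) with outside⇒≡v₁ v h
  ... | refl = cong (v ,_) (T-irr _ h (proj₂ v₁′))

  v₁-touches-G : touches Γ G v₁ ≡ true
  v₁-touches-G = Equivalence.to T-≡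
    (any-intro (λ u → inTail u ∧ adj u v₁) enum
               (∧⁺ (∈tail⇒inTail v₂ (here refl)) (adj-symᵀ (∧⁻ˡ (∧⁻ʳ {all _ enum} hp)))) (enum-complete v₂))

  σ : Iso P₂ Δ
  σ = record
    { to       = to
    ; from     = λ { nothing → Fin.zero ; (just _) → Fin.suc Fin.zero }
    ; to-from  = λ { nothing → refl ; (just y) → cong just (sym (outside≡v₁′ y)) }
    ; from-to  = λ { Fin.zero → refl ; (Fin.suc Fin.zero) → refl }
    ; adj-pres = adj-pres
    }
    where
      to : Fin 2 → VC Γ G
      to Fin.zero    = nothing
      to (Fin.suc _) = just v₁′
      adj-pres : ∀ i j → adjC Γ G (to i) (to j) ≡ Graph.adj P₂ i j
      adj-pres Fin.zero           Fin.zero           = refl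
      adj-pres Fin.zero           (Fin.suc Fin.zero) = v₁-touches-G
      adj-pres (Fin.suc Fin.zero) Fin.zero           = v₁-touches-G
      adj-pres (Fin.suc Fin.zero) (Fin.suc Fin.zero) = adj-irrefl v₁

  attach : (xs : List V) → (∀ v → v ∈ xs → T (inTail v)) → List (Sub inTail)
  attach []       inG = []
  attach (x ∷ xs) inG = (x , inG x (here refl)) ∷ attach xs (λ v v∈ → inG v (there v∈))

  map-proj₁-attach : ∀ xs inG → map proj₁ (attach xs inG) ≡ xs
  map-proj₁-attach []       inG = refl
  map-proj₁-attach (x ∷ xs) inG = cong (x ∷_) (map-proj₁-attach xs (λ v v∈ → inG v (there v∈)))

  count-attach : ∀ v h xs inG → count R (v , h) (attach xs inG) ≡ count Γ v xs
  count-attach v h []       inG = refl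
  count-attach v h (x ∷ xs) inG with v ≟ x
  ... | yes refl = cong suc (count-attach v h xs (λ w w∈ → inG w (there w∈)))
  ... | no  _    = count-attach v h xs (λ w w∈ → inG w (there w∈))

  chain-attach : ∀ xs inG → chain R (attach xs inG) ≡ chain Γ xs
  chain-attach []           inG = refl
  chain-attach (x ∷ [])     inG = refl
  chain-attach (x ∷ y ∷ xs) inG = cong (adj x y ∧_) (chain-attach (y ∷ xs) (λ v v∈ → inG v (there v∈)))

  tail : HamPath R
  tail = attach (v₂ ∷ r) ∈tail⇒inTail , isHam-tail
    where
      isHam-tail : T (isHam R (attach (v₂ ∷ r) ∈tail⇒inTail))
      isHam-tail = ∧⁺ (all-intro _ (Graph.enum R) λ { (v , h) _ → ≡⇒≡ᵇ _ 1
                                    (trans (count-attach v h (v₂ ∷ r) ∈tail⇒inTail) (inTail⇒count≡1 v h)) })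
                      (subst T (sym (chain-attach (v₂ ∷ r) ∈tail⇒inTail)) tail-chain)

  private
    module Δ = Cycles Δ

    nothing≢just : ∀ {y} → _≢_ {A = VC Γ G} nothing (just y)
    nothing≢just ()

  isHam-G-v₁ : T (isHam Δ (nothing ∷ just v₁′ ∷ []))
  isHam-G-v₁ = ∧⁺ (all-intro _ (Graph.enum Δ) once) (∧⁺ (≡true⇒T v₁-touches-G) tt)
    where
      once : ∀ y → y ∈ Graph.enum Δ → T (count Δ y (nothing ∷ just v₁′ ∷ []) ≡ᵇ 1)
      once nothing  _ = ≡⇒≡ᵇ _ 1 (trans (Δ.count-head nothing (just v₁′ ∷ []))
                                        (cong suc (Δ.count-≢ nothing (just v₁′) [] nothing≢just)))
      once (just y) _ rewrite outside≡v₁′ y =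
        ≡⇒≡ᵇ _ 1 (trans (Δ.count-≢ (just v₁′) nothing (just v₁′ ∷ []) (nothing≢just ∘ sym)) (Δ.count-head (just v₁′) []))

  isHam-v₁-G : T (isHam Δ (just v₁′ ∷ nothing ∷ []))
  isHam-v₁-G = ∧⁺ (all-intro _ (Graph.enum Δ) once) (∧⁺ (≡true⇒T v₁-touches-G) tt)
    where
      once : ∀ y → y ∈ Graph.enum Δ → T (count Δ y (just v₁′ ∷ nothing ∷ []) ≡ᵇ 1)
      once nothing  _ = ≡⇒≡ᵇ _ 1 (trans (Δ.count-≢ nothing (just v₁′) (nothing ∷ []) nothing≢just) (Δ.count-head nothing []))
      once (just y) _ rewrite outside≡v₁′ y =
        ≡⇒≡ᵇ _ 1 (trans (Δ.count-head (just v₁′) (nothing ∷ []))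
                        (cong suc (Δ.count-≢ (just v₁′) nothing [] (nothing≢just ∘ sym))))

-- The generator, inserted at the tail tube of a Hamiltonian path l, gives rot l − l
-- (where rot l is dropped when it is not a path).
module Turn {c ℓ : Level} (K : Field c ℓ) (Γ : Graph) (v₁ v₂ : Graph.V Γ) (r : List (Graph.V Γ))
            (hp : T (isHam Γ (v₁ ∷ v₂ ∷ r))) where
  open Field K renaming (refl to ≈-refl; sym to ≈-sym; trans to ≈-trans)
  open import Relation.Binary.Reasoning.Setoid setoid
  open FormalSums K
  open TailTube Γ v₁ v₂ r hp
  open Substitution K Γ G using (sub)
  open Composition K Γ G using (eval-compose; sumOver-composeB)

  private
    l = v₁ ∷ v₂ ∷ r
    Δ = contract Γ G

  turn : HVec K Γ
  turn = compose K Γ G (relabel K σ (relation K)) ((1# , tail) ∷ [])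

  turn∈InSub : InSub K Γ turn
  turn∈InSub = act G (iso σ gen) ((1# , tail) ∷ [])

  eval-turn : ∀ f → eval turn (f ∘ proj₁) ≈ when (isHam Γ (rot1 Γ l)) (f (rot1 Γ l)) + (- 1#) * f l
  eval-turn f = begin
    eval turn (f ∘ proj₁)
      ≈⟨ eval-compose (relabel K σ (relation K)) ((1# , tail) ∷ []) (f ∘ proj₁) ⟩
    eval (relabel K σ (relation K)) (λ P → 1# * sumOver (composeB K Γ G P tail) (f ∘ proj₁) + 0#)
      ≈⟨ eval-cong (relabel K σ (relation K))
                   (λ P → ≈-trans (+-identityʳ _) (≈-trans (*-identityˡ _) (sumOver-composeB P tail f))) ⟩
    eval (relabel K σ (relation K)) (g ∘ proj₁)
      ≈⟨ Relabelling.eval-relabel K σ (relation K) g ⟩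
    1# * when (isHam Δ (nothing ∷ just v₁′ ∷ [])) (g (nothing ∷ just v₁′ ∷ []))
      + ((- 1#) * when (isHam Δ (just v₁′ ∷ nothing ∷ [])) (g (just v₁′ ∷ nothing ∷ [])) + 0#)
      ≈⟨ +-cong (≈-trans (*-identityˡ _) (≡⇒≈ (when-T _ isHam-G-v₁)))
                (≈-trans (+-identityʳ _) (*-cong ≈-refl (≡⇒≈ (when-T _ isHam-v₁-G)))) ⟩
    g (nothing ∷ just v₁′ ∷ []) + (- 1#) * g (just v₁′ ∷ nothing ∷ [])
      ≈⟨ +-cong (≡⇒≈ (cong g′ sub-G-v₁)) (*-cong ≈-refl (≡⇒≈ (trans (cong g′ sub-v₁-G) (when-T (f l) hp)))) ⟩
    when (isHam Γ (rot1 Γ l)) (f (rot1 Γ l)) + (- 1#) * f l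
      ∎
    where
      g′ : List (Graph.V Γ) → Carrier
      g′ s = when (isHam Γ s) (f s)
      g : List (VC Γ G) → Carrier
      g p = g′ (sub p (proj₁ tail))
      sub-G-v₁ : sub (nothing ∷ just v₁′ ∷ []) (proj₁ tail) ≡ rot1 Γ l
      sub-G-v₁ = cong (_++ v₁ ∷ []) (map-proj₁-attach (v₂ ∷ r) ∈tail⇒inTail)
      sub-v₁-G : sub (just v₁′ ∷ nothing ∷ []) (proj₁ tail) ≡ l
      sub-v₁-G = cong (v₁ ∷_) (trans (++-identityʳ _) (map-proj₁-attach (v₂ ∷ r) ∈tail⇒inTail))

module KernelInSubmodule {c ℓ : Level} (K : Field c ℓ) (Γ : Graph) (e₀ : Graph.V Γ) where
  open Field K hiding (zero) renaming (refl to ≈-refl; sym to ≈-sym; trans to ≈-trans)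
  open import Relation.Binary.Reasoning.Setoid setoid
  open Graph Γ
  open FormalSums K
  open Cycles Γ
  open Anchored e₀
  open Coefficients K Γ

  Generated : ((List V → Carrier) → Carrier) → Set (lsuc 0ℓ ⊔ c ⊔ ℓ)
  Generated spec = Σ (HVec K Γ) λ d → InSub K Γ d × (∀ f → eval d (f ∘ proj₁) ≈ spec f)

  ⊖∈InSub : ∀ {u w} → InSub K Γ u → InSub K Γ w → InSub K Γ (u ⊖ w)
  ⊖∈InSub u∈ w∈ = add u∈ (scale (- 1#) w∈)

  rot-difference : ∀ l → T (isCyc Γ l) → Generated (λ f → f (rot l) + (- 1#) * f l)
  rot-difference []             _ = [] , zero , λ f → ≈-sym (x≈y⇒x-y≈0 _ _ ≈-refl)
  rot-difference (v ∷ [])       _ = [] , zero , λ f → ≈-sym (x≈y⇒x-y≈0 _ _ ≈-refl)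
  rot-difference (v₁ ∷ v₂ ∷ r)  c = turn , turn∈InSub , λ f →
    ≈-trans (eval-turn f) (+-cong (≡⇒≈ (when-T _ (isCyc⇒isHam (rot (v₁ ∷ v₂ ∷ r)) (isCyc-rot (v₁ ∷ v₂ ∷ r) c)))) ≈-refl)
    where open Turn K Γ v₁ v₂ r (isCyc⇒isHam (v₁ ∷ v₂ ∷ r) c)

  rotN-difference : ∀ k l → T (isCyc Γ l) → Generated (λ f → f l + (- 1#) * f (rotN k l))
  rotN-difference zero    l _ = [] , zero , λ f → ≈-sym (x≈y⇒x-y≈0 _ _ ≈-refl)
  rotN-difference (suc k) l c with rot-difference l c | rotN-difference k (rot l) (isCyc-rot l c)
  ... | d₁ , d₁∈ , eval-d₁ | d₂ , d₂∈ , eval-d₂ = d₂ ⊖ d₁ , ⊖∈InSub d₂∈ d₁∈ , λ f → begin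
    eval (d₂ ⊖ d₁) (f ∘ proj₁)
      ≈⟨ eval-⊖ d₂ d₁ _ ⟩
    eval d₂ (f ∘ proj₁) + (- 1#) * eval d₁ (f ∘ proj₁)
      ≈⟨ +-cong (eval-d₂ f) (*-cong ≈-refl (eval-d₁ f)) ⟩
    (f (rot l) + (- 1#) * f (rotN k (rot l))) + (- 1#) * (f (rot l) + (- 1#) * f l)
      ≈⟨ telescope _ _ _ ⟩
    f l + (- 1#) * f (rotN k (rot l)) ∎

  -- Modulo InSub, a path is its canonical rotation if it is a cycle, and 0 otherwise.
  reduction : ∀ (p : HamPath Γ) → Generated (λ f → f (proj₁ p) + (- 1#) * when (isCyc Γ (proj₁ p)) (f (canon (proj₁ p))))
  reduction (l , hl) with T? (isCyc Γ l)
  ... | yes c with rotN-difference (anchorIndex l) l c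
  ...   | d , d∈ , eval-d = d , d∈ , λ f → ≈-trans (eval-d f) (+-cong ≈-refl (*-cong ≈-refl (≡⇒≈ (sym (when-T _ c)))))
  reduction ([]           , hl) | no nc = ⊥-elim (nc (∧⁺ hl tt))
  reduction (_ ∷ []       , hl) | no nc = ⊥-elim (nc (∧⁺ hl tt))
  reduction (_ ∷ _ ∷ []   , hl) | no nc = ⊥-elim (nc (∧⁺ hl tt))
  reduction (v₁ ∷ v₂ ∷ z ∷ r , hl) | no nc = scaleH K (- 1#) turn , scale (- 1#) turn∈InSub , λ f → begin
    eval (scaleH K (- 1#) turn) (f ∘ proj₁)                      ≈⟨ eval-scale (- 1#) turn _ ⟩
    (- 1#) * eval turn (f ∘ proj₁)                               ≈⟨ *-cong ≈-refl (eval-turn f) ⟩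
    (- 1#) * (when (isHam Γ (rot l)) (f (rot l)) + (- 1#) * f l)
      ≈⟨ *-cong ≈-refl (≈-trans (+-cong (when-¬T _ rot-not-path) ≈-refl) (+-identityˡ _)) ⟩
    (- 1#) * ((- 1#) * f l)                                      ≈⟨ -1*[-1*x]≈x (f l) ⟩
    f l                                                          ≈⟨ +-identityʳ (f l) ⟨
    f l + 0#                                                     ≈⟨ +-cong ≈-refl (zeroʳ (- 1#)) ⟨
    f l + (- 1#) * 0#                                            ≈⟨ +-cong ≈-refl (*-cong ≈-refl (when-¬T _ nc)) ⟨
    f l + (- 1#) * when (isCyc Γ l) (f (canon l))                ∎
    where
      l = v₁ ∷ v₂ ∷ z ∷ r
      open Turn K Γ v₁ v₂ (z ∷ r) hl
      rot-not-path : ¬ T (isHam Γ (rot l))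
      rot-not-path h = nc (∧⁺ hl (∨⁺ʳ {length l ≤ᵇ 2} (chain-snoc⁻ v₂ (z ∷ r) v₁ (∧⁻ʳ {all _ enum} h))))

  reductionSum : HVec K Γ → HVec K Γ
  reductionSum []            = []
  reductionSum ((a , p) ∷ u) = scaleH K a (proj₁ (reduction p)) ++ reductionSum u

  reductionSum∈InSub : ∀ u → InSub K Γ (reductionSum u)
  reductionSum∈InSub []            = zero
  reductionSum∈InSub ((a , p) ∷ u) = add (scale a (proj₁ (proj₂ (reduction p)))) (reductionSum∈InSub u)

  eval-reductionSum : ∀ u f → eval (reductionSum u) (f ∘ proj₁)
                              ≈ eval u (λ k → f (proj₁ k) + (- 1#) * when (isCyc Γ (proj₁ k)) (f (canon (proj₁ k))))
  eval-reductionSum []            f = ≈-refl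
  eval-reductionSum ((a , p) ∷ u) f =
    ≈-trans (eval-++ (scaleH K a (proj₁ (reduction p))) (reductionSum u) _)
            (+-cong (≈-trans (eval-scale a (proj₁ (reduction p)) (f ∘ proj₁))
                             (*-cong ≈-refl (proj₂ (proj₂ (reduction p)) f)))
                    (eval-reductionSum u f))

  close≈0⇒InSub : ∀ x → _≈C_ K (close K Γ x) [] → InSub K Γ x
  close≈0⇒InSub x close≈0 = resp reductionSum≈x (reductionSum∈InSub x)
    where
      reductionSum≈x : _≈H_ K (reductionSum x) x
      reductionSum≈x L = begin
        coeffH K Γ (reductionSum x) (proj₁ L)                      ≈⟨ coeffH-eval (reductionSum x) (proj₁ L) ⟩
        eval (reductionSum x) (δ ∘ proj₁)                          ≈⟨ eval-reductionSum x δ ⟩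
        eval x (λ k → δ (proj₁ k) + (- 1#) * cycCanon (proj₁ k))   ≈⟨ eval-+ x _ _ ⟩
        eval x (δ ∘ proj₁) + eval x (λ k → (- 1#) * cycCanon (proj₁ k))
                                                                   ≈⟨ +-cong ≈-refl (eval-*ˡ x (- 1#) _) ⟩
        eval x (δ ∘ proj₁) + (- 1#) * eval x (cycCanon ∘ proj₁)    ≈⟨ +-cong ≈-refl (*-cong ≈-refl
                                                                        (close≈0⇒eval≈0 x cycCanon off inv close≈0)) ⟩
        eval x (δ ∘ proj₁) + (- 1#) * 0#                           ≈⟨ ≈-trans (+-cong ≈-refl (zeroʳ _)) (+-identityʳ _) ⟩
        eval x (δ ∘ proj₁)                                         ≈⟨ coeffH-eval x (proj₁ L) ⟨
        coeffH K Γ x (proj₁ L)                                     ∎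
        where
          δ : List V → Carrier
          δ m = ind (sameList Γ m (proj₁ L))
          cycCanon : List V → Carrier
          cycCanon l = when (isCyc Γ l) (δ (canon l))
          off : VanishesOffCycles cycCanon
          off (l , _) nc = when-¬T _ nc
          inv : RotationInvariant cycCanon
          inv l c = ≡⇒≈ (cong₂ when (isCyc-rot-≡ l) (cong δ (canon-rot l (isHam⇒count≡1 l e₀ (isCyc⇒isHam l c)))))

module Surjectivity {c ℓ : Level} (K : Field c ℓ) (Γ : Graph) where

  asPaths : CVec K Γ → HVec K Γ
  asPaths []                  = []
  asPaths ((a , (l , c)) ∷ y) = (a , (l , isCyc⇒isHam l c)) ∷ asPaths y
    where open Cycles Γ

  close-asPaths : ∀ y → close K Γ (asPaths y) ≡ y
  close-asPaths []                  = refl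
  close-asPaths ((a , (l , c)) ∷ y) =
    trans (consIf-T (isCyc Γ l) c (λ h → (a , (l , h))) _) (cong ((a , (l , c)) ∷_) (close-asPaths y))

  close-surjective : ∀ (y : CVec K Γ) → Σ (HVec K Γ) (λ x → _≈C_ K (close K Γ x) y)
  close-surjective y = asPaths y , λ z → ≡⇒≈ (cong (λ w → coeffC K Γ w (proj₁ z)) (close-asPaths y))
    where open FormalSums K using (≡⇒≈)

theorem3p2p1 : ∀ {c ℓ} (K : Field c ℓ) →
    ((Γ : Graph) → Connected Γ → (y : CVec K Γ) →
      Σ (HVec K Γ) (λ x → _≈C_ K (close K Γ x) y))
    × ((Γ : Graph) → Connected Γ → (x : HVec K Γ) →
      (_≈C_ K (close K Γ x) [] → InSub K Γ x) × (InSub K Γ x → _≈C_ K (close K Γ x) []))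
theorem3p2p1 K =
  (λ Γ _ → Surjectivity.close-surjective K Γ) ,
  (λ Γ (e₀ , _) x → KernelInSubmodule.close≈0⇒InSub K Γ e₀ x , SubmoduleInKernel.close≈0-of-InSub K)
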